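{- Let $T$ and $T'$ be spiders with ${\mathbf S}_T(q,r)={\mathbf S}_{T'}(q,r)$. Then $T$ and $T'$ are isomorphic. (That is, a spider $T_\lambda$, $\lambda\vdash n-1$ with $\ell(\lambda)\geq 3$, can be reconstructed from its subtree polynomial.)
   Context: A spider is a tree with exactly one vertex of degree $\geq 3$ (the torso); equivalently, a collection of edge-disjoint paths (legs) sharing a common endpoint. For a partition $\lambda\vdash n-1$ with $\ell(\lambda)\ge 3$ parts, $T_\lambda$ is the spider on $n$ vertices whose leg lengths (numbers of edges) are the parts of $\lambda$. The subtree polynomial of a tree $T$ is ${\mathbf S}_T(q,r)=\sum_S q^{\#S} r^{\#L(S)}$, summed over all subtrees $S$ with at least one edge, where $\#S$ is the number of edges of $S$ and $L(S)$ its set of leaf edges (edges incident to a vertex of degree 1 in $S$). -}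

module Defs where

open import Data.Nat using (ℕ; zero; suc; _+_; _≤_; _≥_; _≡ᵇ_)
open import Data.Bool using (Bool; true; false; _∧_; _∨_; not; if_then_else_)
open import Data.List using (List; []; _∷_; _++_; length; map; concatMap; foldr)
open import Data.Nat.ListAction using (sum)
open import Data.Bool.ListAction using (any; all)
open import Data.List.Relation.Unary.All using (All)
open import Data.List.Relation.Unary.Linked using (Linked)
open import Data.List.Membership.Propositional using (_∈_)
open import Data.Product using (_×_; _,_; proj₁; proj₂; Σ)
open import Data.Sum using (_⊎_)
open import Data.Fin using (Fin; toℕ)
open import Function.Bundles using (_↔_; Inverse)
open import Relation.Binary.PropositionalEquality using (_≡_)

-- Graphs on vertex set {0,…,n-1} ⊆ ℕ given by a list of (undirected) edges.

Edge : Set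
Edge = ℕ × ℕ

IsSpiderPartition : List ℕ → Set
IsSpiderPartition ls = All (1 ≤_) ls × Linked _≥_ ls × (3 ≤ length ls)

-- The spider T_λ: torso is vertex 0; the legs get consecutive fresh vertices.
-- A leg of length l starting at vertex `prev`, fresh vertices c, c+1, …
legEdges : ℕ → ℕ → ℕ → List Edge
legEdges prev c zero    = []
legEdges prev c (suc l) = (prev , c) ∷ legEdges c (suc c) l

spiderEdges′ : ℕ → List ℕ → List Edge
spiderEdges′ c []       = []
spiderEdges′ c (l ∷ ls) = legEdges 0 c l ++ spiderEdges′ (c + l) ls

spiderEdges : List ℕ → List Edge
spiderEdges ls = spiderEdges′ 1 ls

spiderSize : List ℕ → ℕ
spiderSize ls = suc (sum ls)

Adj : List Edge → ℕ → ℕ → Set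
Adj E u v = ((u , v) ∈ E) ⊎ ((v , u) ∈ E)

record _⇔ₜ_ (A B : Set) : Set where
  field
    to   : A → B
    from : B → A

Isomorphic : ℕ → List Edge → ℕ → List Edge → Set
Isomorphic n E n′ E′ =
  Σ (Fin n ↔ Fin n′) λ f →
    ∀ (u v : Fin n) → Adj E (toℕ u) (toℕ v) ⇔ₜ Adj E′ (toℕ (Inverse.to f u)) (toℕ (Inverse.to f v))

sublists : {A : Set} → List A → List (List A)
sublists []       = [] ∷ []
sublists (x ∷ xs) = let r = sublists xs in map (x ∷_) r ++ r

memᵇ : ℕ → List ℕ → Bool
memᵇ v = any (λ w → v ≡ᵇ w)

incident : ℕ → Edge → Bool
incident v (a , b) = (v ≡ᵇ a) ∨ (v ≡ᵇ b)

vertices : List Edge → List ℕ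
vertices = foldr (λ e acc → add (proj₁ e) (add (proj₂ e) acc)) []
  where
  add : ℕ → List ℕ → List ℕ
  add v acc = if memᵇ v acc then acc else v ∷ acc

countᵇ : {A : Set} → (A → Bool) → List A → ℕ
countᵇ p []       = 0
countᵇ p (x ∷ xs) = if p x then suc (countᵇ p xs) else countᵇ p xs

degree : List Edge → ℕ → ℕ
degree S v = countᵇ (incident v) S

step : List Edge → List ℕ → List ℕ
step S R = R ++ concatMap (λ e → if memᵇ (proj₁ e) R ∨ memᵇ (proj₂ e) R
                                   then proj₁ e ∷ proj₂ e ∷ [] else []) S

iter : ℕ → (List ℕ → List ℕ) → List ℕ → List ℕ
iter zero    f x = x
iter (suc k) f x = f (iter k f x)

connectedᵇ : List Edge → Bool
connectedᵇ []             = true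
connectedᵇ S@((a , b) ∷ _) =
  let R = iter (length S) (step S) (a ∷ b ∷ []) in
  all (λ v → memᵇ v R) (vertices S)

isSubtreeᵇ : List Edge → Bool
isSubtreeᵇ []      = false
isSubtreeᵇ S@(_ ∷ _) = connectedᵇ S ∧ (length (vertices S) ≡ᵇ suc (length S))

leafEdgeᵇ : List Edge → Edge → Bool
leafEdgeᵇ S (a , b) = (degree S a ≡ᵇ 1) ∨ (degree S b ≡ᵇ 1)

numLeafEdges : List Edge → ℕ
numLeafEdges S = countᵇ (leafEdgeᵇ S) S

-- coefficient of q^i r^j in S_T(q,r): number of subtrees S (≥ 1 edge) of T with
-- #S = i edges and #L(S) = j leaf edges.
subtreeCoeff : List Edge → ℕ → ℕ → ℕ
subtreeCoeff E i j =
  countᵇ (λ S → isSubtreeᵇ S ∧ (length S ≡ᵇ i) ∧ (numLeafEdges S ≡ᵇ j))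
         (sublists E)

SameSubtreePoly : List Edge → List Edge → Set
SameSubtreePoly E E′ = ∀ i j → subtreeCoeff E i j ≡ subtreeCoeff E′ i j

module Submission where

-- A subtree S meeting every leg contains the torso, so it meets each leg in an initial
-- segment and has exactly one leaf edge per leg.  Conversely, S has #S + 1 vertices, and
-- bounding its leaf edges leg by leg (a component of S on a leg has at most two leaf edges,
-- and only one if it contains the torso) shows that ℓ ≥ 3 leaf edges force S to contain
-- the torso with degree ℓ and to meet every leg in an initial segment.  Hence the
-- coefficient of r^ℓ is ∏ⱼ (q + ⋯ + q^λⱼ) = q^ℓ ∏ⱼ (1 - q^λⱼ) / (1 - q)^ℓ, and ∏ⱼ (1 - q^λⱼ)
-- determines λ: its smallest part is the least positive degree with a nonzero coefficient,
-- and that factor can be cancelled.  The number ℓ of legs is read off the top coefficient,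
-- the spider being its only subtree with all the edges.

open import Defs
open import Data.Bool using (Bool; true; false; _∧_; _∨_; not; if_then_else_; T)
open import Data.Bool.ListAction using (any; all)
open import Data.Bool.Properties
  using (∧-conicalˡ; ∧-conicalʳ; ∧-zeroʳ; ∨-zeroʳ; ∧-identityʳ; ∧-assoc; ∧-comm; ∨-assoc; ⇔→≡)
open import Data.Fin using (Fin)
open import Data.Integer using (ℤ; +_; -[1+_]; 0ℤ; 1ℤ; +≤+) renaming (_+_ to _+ℤ_; _-_ to _-ℤ_; _≤_ to _≤ℤ_)
import Data.Integer.Properties as ℤ
import Data.Integer.Solver as ℤ-Solver
open import Data.List using (List; []; _∷_; _++_; length; map; reverse; filter; concatMap)
open import Data.List.Membership.Propositional using (_∈_)
open import Data.List.Properties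
  using (∷-injectiveˡ; filter-++; filter-all; filter-none; ++-identityʳ; length-++; map-++; map-∘; map-cong-local;
         unfold-reverse; reverse-injective)
open import Data.List.Relation.Binary.Permutation.Propositional as ↭ using (_↭_; ↭-sym)
open import Data.List.Relation.Binary.Permutation.Propositional.Properties using (All-resp-↭; ↭-reverse)
open import Data.List.Relation.Binary.Sublist.Propositional using (_⊆_; []; _∷_; _∷ʳ_; ⊆-refl)
open import Data.List.Relation.Binary.Sublist.Propositional.Properties using (All-resp-⊆; length-mono-≤)
open import Data.List.Relation.Unary.All as All using (All; []; _∷_)
import Data.List.Relation.Unary.All.Properties as All
open import Data.List.Relation.Unary.AllPairs using (AllPairs; []; _∷_)
import Data.List.Relation.Unary.AllPairs.Properties as AllPairs
open import Data.List.Relation.Unary.Any using (here; there)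
open import Data.List.Relation.Unary.Linked using (Linked)
open import Data.List.Relation.Unary.Linked.Properties using (Linked⇒AllPairs)
open import Data.Nat using (ℕ; zero; suc; _+_; _∸_; _≤_; _<_; _≥_; _≤?_; _<?_; _≤ᵇ_; _≡ᵇ_; _≟_; z≤n; s≤s; z<s)
open import Data.Nat.ListAction using (sum)
open import Data.Nat.ListAction.Properties using (sum-++)
open import Data.Nat.Properties
import Data.Nat.Solver as ℕ-Solver
open import Data.Product using (_×_; _,_; proj₁; proj₂; ∃)
open import Data.Sum as Sum using (_⊎_; inj₁; inj₂)
open import Data.Unit using (tt)
open import Function using (_∘_; flip; id)
open import Function.Bundles using (mk⇔)
open import Function.Construct.Identity using (↔-id)
open import Relation.Binary.Definitions using (tri<; tri≈; tri>)
open import Relation.Binary.PropositionalEquality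
open import Relation.Nullary.Decidable using (yes; no; dec-true; dec-false)
open import Relation.Nullary.Negation using (contradiction)

≡ᵇ-refl : ∀ n → (n ≡ᵇ n) ≡ true
≡ᵇ-refl n = dec-true (n ≟ n) refl

≢⇒≡ᵇ-false : ∀ {m n} → m ≢ n → (m ≡ᵇ n) ≡ false
≢⇒≡ᵇ-false {m} {n} = dec-false (m ≟ n)

≡ᵇ-true⇒≡ : ∀ {m n} → (m ≡ᵇ n) ≡ true → m ≡ n
≡ᵇ-true⇒≡ {m} {n} e = ≡ᵇ⇒≡ m n (subst T (sym e) tt)

∧-true : ∀ {a b} → a ∧ b ≡ true → a ≡ true × b ≡ true
∧-true {a} {b} a∧b = ∧-conicalˡ a b a∧b , ∧-conicalʳ a b a∧b

when : Bool → ℕ → ℕ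
when b n = if b then n else 0

countᵇ-++ : ∀ {A : Set} (p : A → Bool) xs ys → countᵇ p (xs ++ ys) ≡ countᵇ p xs + countᵇ p ys
countᵇ-++ p []       ys = refl
countᵇ-++ p (x ∷ xs) ys with p x
... | true  = cong suc (countᵇ-++ p xs ys)
... | false = countᵇ-++ p xs ys

countᵇ-map : ∀ {A B : Set} (p : B → Bool) (f : A → B) xs → countᵇ p (map f xs) ≡ countᵇ (p ∘ f) xs
countᵇ-map p f []       = refl
countᵇ-map p f (x ∷ xs) with p (f x)
... | true  = cong suc (countᵇ-map p f xs)
... | false = countᵇ-map p f xs

countᵇ-cong : ∀ {A : Set} {p q : A → Bool} {xs} → All (λ x → p x ≡ q x) xs → countᵇ p xs ≡ countᵇ q xs
countᵇ-cong [] = refl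
countᵇ-cong {q = q} {x ∷ _} (px≡qx ∷ e) rewrite px≡qx with q x
... | true  = cong suc (countᵇ-cong e)
... | false = countᵇ-cong e

countᵇ-none : ∀ {A : Set} {p : A → Bool} {xs} → All (λ x → p x ≡ false) xs → countᵇ p xs ≡ 0
countᵇ-none []             = refl
countᵇ-none (px≡false ∷ e) rewrite px≡false = countᵇ-none e

countᵇ≤length : ∀ {A : Set} (p : A → Bool) xs → countᵇ p xs ≤ length xs
countᵇ≤length p []       = z≤n
countᵇ≤length p (x ∷ xs) with p x
... | true  = s≤s (countᵇ≤length p xs)
... | false = m≤n⇒m≤1+n (countᵇ≤length p xs)

sum-map-++ : ∀ {A : Set} (f : A → ℕ) xs ys → sum (map f (xs ++ ys)) ≡ sum (map f xs) + sum (map f ys)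
sum-map-++ f xs ys = trans (cong sum (map-++ f xs ys)) (sum-++ (map f xs) (map f ys))

sum-map-cong : ∀ {A : Set} {f g : A → ℕ} {xs} → All (λ x → f x ≡ g x) xs → sum (map f xs) ≡ sum (map g xs)
sum-map-cong = cong sum ∘ map-cong-local

sum-map-zero : ∀ {A : Set} {f : A → ℕ} {xs} → All (λ x → f x ≡ 0) xs → sum (map f xs) ≡ 0
sum-map-zero []           = refl
sum-map-zero (fx≡0 ∷ e) rewrite fx≡0 = sum-map-zero e

sublists-⊆ : ∀ {A : Set} (xs : List A) → All (_⊆ xs) (sublists xs)
sublists-⊆ []       = [] ∷ []
sublists-⊆ (x ∷ xs) = All.++⁺ (All.map⁺ (All.map (refl ∷_) (sublists-⊆ xs))) (All.map (x ∷ʳ_) (sublists-⊆ xs))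

⊆-++-split : ∀ {A : Set} {S : List A} xs ys → S ⊆ xs ++ ys → ∃ λ s → ∃ λ t → S ≡ s ++ t × s ⊆ xs × t ⊆ ys
⊆-++-split []       ys S⊆ys = [] , _ , refl , [] , S⊆ys
⊆-++-split (x ∷ xs) ys (refl ∷ S⊆) with ⊆-++-split xs ys S⊆
... | s , t , refl , s⊆xs , t⊆ys = x ∷ s , t , refl , refl ∷ s⊆xs , t⊆ys
⊆-++-split (x ∷ xs) ys (.x ∷ʳ S⊆) with ⊆-++-split xs ys S⊆
... | s , t , refl , s⊆xs , t⊆ys = s , t , refl , x ∷ʳ s⊆xs , t⊆ys

sum-sublists-∷ : ∀ {A : Set} (F : List A → ℕ) x xs →
  sum (map F (sublists (x ∷ xs))) ≡ sum (map (F ∘ (x ∷_)) (sublists xs)) + sum (map F (sublists xs))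
sum-sublists-∷ F x xs = begin
  sum (map F (map (x ∷_) (sublists xs) ++ sublists xs))
    ≡⟨ sum-map-++ F (map (x ∷_) (sublists xs)) (sublists xs) ⟩
  sum (map F (map (x ∷_) (sublists xs))) + sum (map F (sublists xs))
    ≡⟨ cong (λ n → sum n + sum (map F (sublists xs))) (map-∘ (sublists xs)) ⟨
  sum (map (F ∘ (x ∷_)) (sublists xs)) + sum (map F (sublists xs)) ∎
  where open ≡-Reasoning

countᵇ-sublists-++ : ∀ {A : Set} (p : List A → Bool) xs ys →
  countᵇ p (sublists (xs ++ ys)) ≡ sum (map (λ s → countᵇ (p ∘ (s ++_)) (sublists ys)) (sublists xs))
countᵇ-sublists-++ p []       ys = sym (+-identityʳ _)
countᵇ-sublists-++ {A} p (x ∷ xs) ys = begin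
  countᵇ p (map (x ∷_) (sublists (xs ++ ys)) ++ sublists (xs ++ ys))
    ≡⟨ countᵇ-++ p (map (x ∷_) (sublists (xs ++ ys))) (sublists (xs ++ ys)) ⟩
  countᵇ p (map (x ∷_) (sublists (xs ++ ys))) + countᵇ p (sublists (xs ++ ys))
    ≡⟨ cong₂ _+_ (trans (countᵇ-map p (x ∷_) (sublists (xs ++ ys))) (countᵇ-sublists-++ (p ∘ (x ∷_)) xs ys))
                 (countᵇ-sublists-++ p xs ys) ⟩
  sum (map (F ∘ (x ∷_)) (sublists xs)) + sum (map F (sublists xs))
    ≡⟨ sum-sublists-∷ F x xs ⟨
  sum (map F (sublists (x ∷ xs))) ∎
  where
  open ≡-Reasoning
  F : List A → ℕ
  F s = countᵇ (p ∘ (s ++_)) (sublists ys)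

-- Formal power series

∑ : ℕ → (ℕ → ℕ) → ℕ
∑ zero    g = 0
∑ (suc n) g = g 0 + ∑ n (g ∘ suc)

∑ℤ : ℕ → (ℕ → ℤ) → ℤ
∑ℤ zero    h = 0ℤ
∑ℤ (suc n) h = h 0 +ℤ ∑ℤ n (h ∘ suc)

+-∑ : ∀ n g → + ∑ n g ≡ ∑ℤ n (+_ ∘ g)
+-∑ zero    g = refl
+-∑ (suc n) g = trans (ℤ.pos-+ (g 0) _) (cong (+ g 0 +ℤ_) (+-∑ n (g ∘ suc)))

∑ℤ-cong : ∀ n {h h′} → h ≗ h′ → ∑ℤ n h ≡ ∑ℤ n h′
∑ℤ-cong zero    e = refl
∑ℤ-cong (suc n) e = cong₂ _+ℤ_ (e 0) (∑ℤ-cong n (e ∘ suc))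

∑ℤ-zero : ∀ n → ∑ℤ n (λ _ → 0ℤ) ≡ 0ℤ
∑ℤ-zero zero    = refl
∑ℤ-zero (suc n) = trans (ℤ.+-identityˡ _) (∑ℤ-zero n)

∑ℤ-last : ∀ n h → ∑ℤ (suc n) h ≡ ∑ℤ n h +ℤ h n
∑ℤ-last zero    h = ℤ.+-comm (h 0) 0ℤ
∑ℤ-last (suc n) h = trans (cong (h 0 +ℤ_) (∑ℤ-last n (h ∘ suc))) (sym (ℤ.+-assoc (h 0) _ _))

-- Integer sequences are the coefficient sequences of formal power series in x;
-- shift a and Δ a multiply a series by x^a and by 1 - x^a.
Seq : Set
Seq = ℕ → ℤ

one : Seq
one zero    = 1ℤ
one (suc _) = 0ℤ

shift : ℕ → Seq → Seq
shift a f i = if a ≤ᵇ i then f (i ∸ a) else 0ℤ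

Δ : ℕ → Seq → Seq
Δ a f i = f i -ℤ shift a f i

≤ᵇ-sound : ∀ {m n} → (m ≤ᵇ n) ≡ true → m ≤ n
≤ᵇ-sound {m} {n} e = ≤ᵇ⇒≤ m n (subst T (sym e) tt)

≤ᵇ-suc : ∀ m n → (suc m ≤ᵇ suc n) ≡ (m ≤ᵇ n)
≤ᵇ-suc zero    n = refl
≤ᵇ-suc (suc m) n = refl

≤ᵇ-+ : ∀ a b i → a ≤ i → (a + b ≤ᵇ i) ≡ (b ≤ᵇ i ∸ a)
≤ᵇ-+ zero    b i       _         = refl
≤ᵇ-+ (suc a) b (suc i) (s≤s a≤i) = trans (≤ᵇ-suc (a + b) i) (≤ᵇ-+ a b i a≤i)

≤ᵇ-+-false : ∀ a b i → (a ≤ᵇ i) ≡ false → (a + b ≤ᵇ i) ≡ false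
≤ᵇ-+-false (suc a) b zero    _ = refl
≤ᵇ-+-false (suc a) b (suc i) e =
  trans (≤ᵇ-suc (a + b) i) (≤ᵇ-+-false a b i (trans (sym (≤ᵇ-suc a i)) e))

shift-cong : ∀ a {f g} → f ≗ g → shift a f ≗ shift a g
shift-cong a f≗g i with a ≤ᵇ i
... | true  = f≗g (i ∸ a)
... | false = refl

Δ-cong : ∀ a {f g} → f ≗ g → Δ a f ≗ Δ a g
Δ-cong a f≗g i = cong₂ _-ℤ_ (f≗g i) (shift-cong a f≗g i)

shift-zipWith : ∀ a (_∙_ : ℤ → ℤ → ℤ) → 0ℤ ∙ 0ℤ ≡ 0ℤ → ∀ f g i →
  shift a (λ j → f j ∙ g j) i ≡ shift a f i ∙ shift a g i
shift-zipWith a _∙_ 0∙0 f g i with a ≤ᵇ i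
... | true  = refl
... | false = sym 0∙0

shift-∑ℤ : ∀ a n (h : ℕ → Seq) i → shift a (λ j → ∑ℤ n (λ k → h k j)) i ≡ ∑ℤ n (λ k → shift a (h k) i)
shift-∑ℤ a n h i with a ≤ᵇ i
... | true  = refl
... | false = sym (∑ℤ-zero n)

shift-shift : ∀ a b f → shift a (shift b f) ≗ shift (a + b) f
shift-shift a b f i with a ≤ᵇ i in a≤ᵇi
... | false rewrite ≤ᵇ-+-false a b i a≤ᵇi = refl
... | true  rewrite ≤ᵇ-+ a b i (≤ᵇ-sound a≤ᵇi) with b ≤ᵇ i ∸ a
...   | true  = cong f (∸-+-assoc i a b)
...   | false = refl

shift-injective : ∀ n {f g} → shift n f ≗ shift n g → f ≗ g
shift-injective n {f} {g} e i
  with e (n + i)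
... | eq rewrite dec-true (n ≤? n + i) (m≤m+n n i) | m+n∸m≡n n i = eq

Δ-shift : ∀ a b f → Δ a (shift b f) ≗ shift b (Δ a f)
Δ-shift a b f i = begin
  shift b f i -ℤ shift a (shift b f) i   ≡⟨ cong (shift b f i -ℤ_) (shift-shift a b f i) ⟩
  shift b f i -ℤ shift (a + b) f i       ≡⟨ cong (λ c → shift b f i -ℤ shift c f i) (+-comm a b) ⟩
  shift b f i -ℤ shift (b + a) f i       ≡⟨ cong (shift b f i -ℤ_) (shift-shift b a f i) ⟨
  shift b f i -ℤ shift b (shift a f) i   ≡⟨ shift-zipWith b _-ℤ_ refl f (shift a f) i ⟨
  shift b (Δ a f) i                      ∎
  where open ≡-Reasoning

Δ-comm : ∀ a b f → Δ a (Δ b f) ≗ Δ b (Δ a f)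
Δ-comm a b f i = begin
  (f i -ℤ s b) -ℤ shift a (Δ b f) i          ≡⟨ cong (f i -ℤ s b -ℤ_) (shift-zipWith a _-ℤ_ refl f (shift b f) i) ⟩
  (f i -ℤ s b) -ℤ (s a -ℤ shift a (shift b f) i)
    ≡⟨ cong (λ x → (f i -ℤ s b) -ℤ (s a -ℤ x)) (trans (shift-shift a b f i) (cong (λ c → shift c f i) (+-comm a b))) ⟩
  (f i -ℤ s b) -ℤ (s a -ℤ shift (b + a) f i)
    ≡⟨ solve 4 (λ x y z w → (x :- y) :- (z :- w) := (x :- z) :- (y :- w)) refl (f i) (s b) (s a) _ ⟩
  (f i -ℤ s a) -ℤ (s b -ℤ shift (b + a) f i)  ≡⟨ cong (λ x → (f i -ℤ s a) -ℤ (s b -ℤ x)) (shift-shift b a f i) ⟨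
  (f i -ℤ s a) -ℤ (s b -ℤ shift b (shift a f) i) ≡⟨ cong (f i -ℤ s a -ℤ_) (shift-zipWith b _-ℤ_ refl f (shift a f) i) ⟨
  (f i -ℤ s a) -ℤ shift b (Δ a f) i          ∎
  where
  open ≡-Reasoning
  open ℤ-Solver.+-*-Solver
  s : ℕ → ℤ
  s c = shift c f i

Δ-cancel : ∀ a {f g} → 1 ≤ a → Δ a f ≗ Δ a g → f ≗ g
Δ-cancel a {f} {g} 1≤a e i = go (suc i) i ≤-refl
  where
  go : ∀ n i → i < n → f i ≡ g i
  go (suc n) i (s≤s i≤n) = begin
    f i                             ≡⟨ solve 2 (λ x y → x := (x :- y) :+ y) refl (f i) (shift a f i) ⟩
    Δ a f i +ℤ shift a f i          ≡⟨ cong₂ _+ℤ_ (e i) shifted ⟩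
    Δ a g i +ℤ shift a g i          ≡⟨ solve 2 (λ x y → x := (x :- y) :+ y) refl (g i) (shift a g i) ⟨
    g i                             ∎
    where
    open ≡-Reasoning
    open ℤ-Solver.+-*-Solver
    shifted : shift a f i ≡ shift a g i
    shifted with a ≤ᵇ i in a≤ᵇi
    ... | true  = go n (i ∸ a) (<-≤-trans (∸-monoʳ-< 1≤a (≤ᵇ-sound a≤ᵇi)) i≤n)
    ... | false = refl

shift-below : ∀ a f {i} → i < a → shift a f i ≡ 0ℤ
shift-below a f {i} i<a rewrite dec-false (a ≤? i) (<⇒≱ i<a) = refl

shift-at : ∀ a f → shift a f a ≡ f 0
shift-at a f rewrite dec-true (a ≤? a) ≤-refl | n∸n≡0 a = refl

one-positive : ∀ {k} → 1 ≤ k → one k ≡ 0ℤ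
one-positive (s≤s _) = refl

nonpositive-1≢0 : ∀ {x} → x ≤ℤ 0ℤ → x -ℤ 1ℤ ≢ 0ℤ
nonpositive-1≢0 {+ zero}   _ ()
nonpositive-1≢0 {+ suc n}  (+≤+ ())
nonpositive-1≢0 { -[1+ n ]} _ ()

∏1-x^ : List ℕ → Seq
∏1-x^ []       = one
∏1-x^ (a ∷ as) = Δ a (∏1-x^ as)

∏1-x^-↭ : ∀ {as bs} → as ↭ bs → ∏1-x^ as ≗ ∏1-x^ bs
∏1-x^-↭ ↭.refl           i = refl
∏1-x^-↭ (↭.prep a p)     = Δ-cong a (∏1-x^-↭ p)
∏1-x^-↭ (↭.swap {xs} a b p) i = trans (Δ-comm a b (∏1-x^ xs) i) (Δ-cong b (Δ-cong a (∏1-x^-↭ p)) i)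
∏1-x^-↭ (↭.trans p q)  i = trans (∏1-x^-↭ p i) (∏1-x^-↭ q i)

∏1-x^-0 : ∀ {as} → All (1 ≤_) as → ∏1-x^ as 0 ≡ 1ℤ
∏1-x^-0 []                      = refl
∏1-x^-0 {a ∷ as} (1≤a ∷ 1≤as)
  rewrite shift-below a (∏1-x^ as) 1≤a | ∏1-x^-0 1≤as = refl

∏1-x^-gap : ∀ {m as k} → All (m ≤_) as → 1 ≤ k → k < m → ∏1-x^ as k ≡ 0ℤ
∏1-x^-gap []                          1≤k k<m = one-positive 1≤k
∏1-x^-gap {as = a ∷ as} (m≤a ∷ m≤as) 1≤k k<m
  rewrite shift-below a (∏1-x^ as) (<-≤-trans k<m m≤a) | ∏1-x^-gap m≤as 1≤k k<m = refl

∏1-x^-min : ∀ {m as} → 1 ≤ m → All (m ≤_) as → ∏1-x^ as m ≤ℤ 0ℤ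
∏1-x^-min 1≤m [] rewrite one-positive 1≤m = ℤ.≤-refl
∏1-x^-min {m} {a ∷ as} 1≤m (m≤a ∷ m≤as) with m≤n⇒m<n∨m≡n m≤a
... | inj₁ m<a rewrite shift-below a (∏1-x^ as) m<a | ℤ.+-identityʳ (∏1-x^ as m) = ∏1-x^-min 1≤m m≤as
... | inj₂ refl rewrite shift-at m (∏1-x^ as) | ∏1-x^-0 (All.map (≤-trans 1≤m) m≤as) =
  ℤ.i≤j⇒i-k≤j 1ℤ (∏1-x^-min 1≤m m≤as)

∏1-x^-min≢0 : ∀ {a as} → 1 ≤ a → All (a ≤_) as → ∏1-x^ (a ∷ as) a ≢ 0ℤ
∏1-x^-min≢0 {a} {as} 1≤a a≤as
  rewrite shift-at a (∏1-x^ as) | ∏1-x^-0 (All.map (≤-trans 1≤a) a≤as) = nonpositive-1≢0 (∏1-x^-min 1≤a a≤as)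

-- The least positive degree with a nonzero coefficient is the smallest part, whose
-- factor can then be cancelled.
∏1-x^-injective-↗ : ∀ {as bs} → AllPairs _≤_ as → AllPairs _≤_ bs → All (1 ≤_) as → All (1 ≤_) bs →
  ∏1-x^ as ≗ ∏1-x^ bs → as ≡ bs
∏1-x^-injective-↗ [] [] _ _ _ = refl
∏1-x^-injective-↗ [] (b≤bs ∷ _) _ (1≤b ∷ _) e =
  contradiction (trans (sym (e _)) (one-positive 1≤b)) (∏1-x^-min≢0 1≤b b≤bs)
∏1-x^-injective-↗ (a≤as ∷ _) [] (1≤a ∷ _) _ e =
  contradiction (trans (e _) (one-positive 1≤a)) (∏1-x^-min≢0 1≤a a≤as)
∏1-x^-injective-↗ {a ∷ as} {b ∷ bs} (a≤as ∷ ↗as) (b≤bs ∷ ↗bs) (1≤a ∷ 1≤as) (1≤b ∷ 1≤bs) e with <-cmp a b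
... | tri< a<b _ _ = contradiction (trans (e a) (∏1-x^-gap (≤-refl ∷ b≤bs) 1≤a a<b)) (∏1-x^-min≢0 1≤a a≤as)
... | tri> _ _ b<a = contradiction (trans (sym (e b)) (∏1-x^-gap (≤-refl ∷ a≤as) 1≤b b<a)) (∏1-x^-min≢0 1≤b b≤bs)
... | tri≈ _ refl _ = cong (a ∷_) (∏1-x^-injective-↗ ↗as ↗bs 1≤as 1≤bs (Δ-cancel a 1≤a e))

AllPairs-reverse : ∀ {R : ℕ → ℕ → Set} {xs} → AllPairs R xs → AllPairs (flip R) (reverse xs)
AllPairs-reverse []                 = []
AllPairs-reverse {xs = x ∷ xs} (Rx ∷ Rxs) rewrite unfold-reverse x xs =
  AllPairs.++⁺ (AllPairs-reverse Rxs) ([] ∷ []) (All.map (_∷ []) (All-resp-↭ (↭-sym (↭-reverse xs)) Rx))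

∏1-x^-injective-↘ : ∀ {as bs} → Linked _≥_ as → Linked _≥_ bs → All (1 ≤_) as → All (1 ≤_) bs →
  ∏1-x^ as ≗ ∏1-x^ bs → as ≡ bs
∏1-x^-injective-↘ {as} {bs} ↘as ↘bs 1≤as 1≤bs e = reverse-injective (∏1-x^-injective-↗
  (AllPairs-reverse (Linked⇒AllPairs (flip ≤-trans) ↘as)) (AllPairs-reverse (Linked⇒AllPairs (flip ≤-trans) ↘bs))
  (All-resp-↭ (↭-sym (↭-reverse as)) 1≤as) (All-resp-↭ (↭-sym (↭-reverse bs)) 1≤bs)
  (λ i → trans (∏1-x^-↭ (↭-reverse as) i) (trans (e i) (sym (∏1-x^-↭ (↭-reverse bs) i)))))

-- boundedCompositions ls k i counts the tuples (aⱼ) with 1 ≤ aⱼ ≤ lⱼ and k + Σ aⱼ = i;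
-- as a series in i it is x^k ∏ⱼ (x + ⋯ + x^lⱼ).
boundedCompositions : List ℕ → ℕ → ℕ → ℕ
boundedCompositions []       k i = if k ≡ᵇ i then 1 else 0
boundedCompositions (l ∷ ls) k i = ∑ l (λ a → boundedCompositions ls (k + suc a) i)

compositionSeries : List ℕ → Seq
compositionSeries ls i = + boundedCompositions ls 0 i

∑shift : ℕ → Seq → Seq
∑shift l g j = ∑ℤ l (λ a → shift (suc a) g j)

shift-one : ∀ k i → + (if k ≡ᵇ i then 1 else 0) ≡ shift k one i
shift-one zero    zero    = refl
shift-one zero    (suc i) = refl
shift-one (suc k) zero    = refl
shift-one (suc k) (suc i) rewrite ≤ᵇ-suc k i = shift-one k i

boundedCompositions-shift : ∀ ls k i → + boundedCompositions ls k i ≡ shift k (compositionSeries ls) i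
compositionSeries-∷ : ∀ l ls → compositionSeries (l ∷ ls) ≗ ∑shift l (compositionSeries ls)

boundedCompositions-shift [] k i = trans (shift-one k i) (shift-cong k (λ j → sym (shift-one 0 j)) i)
boundedCompositions-shift (l ∷ ls) k i = begin
  + ∑ l (λ a → boundedCompositions ls (k + suc a) i) ≡⟨ +-∑ l _ ⟩
  ∑ℤ l (λ a → + boundedCompositions ls (k + suc a) i) ≡⟨ ∑ℤ-cong l (λ a → boundedCompositions-shift ls (k + suc a) i) ⟩
  ∑ℤ l (λ a → shift (k + suc a) G i)                  ≡⟨ ∑ℤ-cong l (λ a → shift-shift k (suc a) G i) ⟨
  ∑ℤ l (λ a → shift k (shift (suc a) G) i)            ≡⟨ shift-∑ℤ k l (λ a → shift (suc a) G) i ⟨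
  shift k (∑shift l G) i                              ≡⟨ shift-cong k (compositionSeries-∷ l ls) i ⟨
  shift k (compositionSeries (l ∷ ls)) i              ∎
  where
  open ≡-Reasoning
  G : Seq
  G = compositionSeries ls

compositionSeries-∷ l ls j = trans (+-∑ l _) (∑ℤ-cong l (λ a → boundedCompositions-shift ls (suc a) j))

Δ₁-∑shift-telescope : ∀ l g i → Δ 1 (∑shift l g) i ≡ shift 1 g i -ℤ shift (suc l) g i
Δ₁-∑shift-telescope zero g i = begin
  0ℤ -ℤ shift 1 (λ _ → 0ℤ) i  ≡⟨ cong (0ℤ -ℤ_) (shift-∑ℤ 1 0 (λ _ → g) i) ⟩
  0ℤ                          ≡⟨ ℤ.+-inverseʳ (shift 1 g i) ⟨
  shift 1 g i -ℤ shift 1 g i  ∎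
  where open ≡-Reasoning
Δ₁-∑shift-telescope (suc l) g i = begin
  ∑shift (suc l) g i -ℤ shift 1 (∑shift (suc l) g) i
    ≡⟨ cong₂ _-ℤ_ (∑ℤ-last l (λ a → shift (suc a) g i))
                  (trans (shift-cong 1 (λ j → ∑ℤ-last l (λ a → shift (suc a) g j)) i)
                           (shift-zipWith 1 _+ℤ_ refl (∑shift l g) (shift (suc l) g) i)) ⟩
  (∑shift l g i +ℤ s) -ℤ (shift 1 (∑shift l g) i +ℤ shift 1 (shift (suc l) g) i)
    ≡⟨ cong (λ x → (∑shift l g i +ℤ s) -ℤ (shift 1 (∑shift l g) i +ℤ x)) (shift-shift 1 (suc l) g i) ⟩
  (∑shift l g i +ℤ s) -ℤ (shift 1 (∑shift l g) i +ℤ s′)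
    ≡⟨ solve 4 (λ x s y s′ → (x :+ s) :- (y :+ s′) := (x :- y) :+ s :- s′) refl (∑shift l g i) s (shift 1 (∑shift l g) i) s′ ⟩
  Δ 1 (∑shift l g) i +ℤ s -ℤ s′
    ≡⟨ cong (λ x → x +ℤ s -ℤ s′) (Δ₁-∑shift-telescope l g i) ⟩
  (shift 1 g i -ℤ s) +ℤ s -ℤ s′
    ≡⟨ solve 3 (λ x s s′ → (x :- s) :+ s :- s′ := x :- s′) refl (shift 1 g i) s s′ ⟩
  shift 1 g i -ℤ s′ ∎
  where
  open ≡-Reasoning
  open ℤ-Solver.+-*-Solver
  s s′ : ℤ
  s  = shift (suc l) g i
  s′ = shift (suc (suc l)) g i

Δ₁-∑shift : ∀ l g → Δ 1 (∑shift l g) ≗ shift 1 (Δ l g)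
Δ₁-∑shift l g i = begin
  Δ 1 (∑shift l g) i                ≡⟨ Δ₁-∑shift-telescope l g i ⟩
  shift 1 g i -ℤ shift (1 + l) g i  ≡⟨ cong (shift 1 g i -ℤ_) (shift-shift 1 l g i) ⟨
  shift 1 g i -ℤ shift 1 (shift l g) i ≡⟨ shift-zipWith 1 _-ℤ_ refl g (shift l g) i ⟨
  shift 1 (Δ l g) i                 ∎
  where open ≡-Reasoning

Δ₁^ : ℕ → Seq → Seq
Δ₁^ zero    f = f
Δ₁^ (suc n) f = Δ₁^ n (Δ 1 f)

Δ₁^-cong : ∀ n {f g} → f ≗ g → Δ₁^ n f ≗ Δ₁^ n g
Δ₁^-cong zero    e = e
Δ₁^-cong (suc n) e = Δ₁^-cong n (Δ-cong 1 e)

Δ₁^-shift : ∀ n b f → Δ₁^ n (shift b f) ≗ shift b (Δ₁^ n f)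
Δ₁^-shift zero    b f i = refl
Δ₁^-shift (suc n) b f i = trans (Δ₁^-cong n (Δ-shift 1 b f) i) (Δ₁^-shift n b (Δ 1 f) i)

Δ₁^-Δ : ∀ n b f → Δ₁^ n (Δ b f) ≗ Δ b (Δ₁^ n f)
Δ₁^-Δ zero    b f i = refl
Δ₁^-Δ (suc n) b f i = trans (Δ₁^-cong n (Δ-comm 1 b f) i) (Δ₁^-Δ n b (Δ 1 f) i)

Δ₁^-compositionSeries : ∀ ls → Δ₁^ (length ls) (compositionSeries ls) ≗ shift (length ls) (∏1-x^ ls)
Δ₁^-compositionSeries []       i = shift-one 0 i
Δ₁^-compositionSeries (l ∷ ls) i = begin
  Δ₁^ n (Δ 1 (compositionSeries (l ∷ ls))) i ≡⟨ Δ₁^-cong n (Δ-cong 1 (compositionSeries-∷ l ls)) i ⟩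
  Δ₁^ n (Δ 1 (∑shift l G)) i                 ≡⟨ Δ₁^-cong n (Δ₁-∑shift l G) i ⟩
  Δ₁^ n (shift 1 (Δ l G)) i                  ≡⟨ Δ₁^-shift n 1 (Δ l G) i ⟩
  shift 1 (Δ₁^ n (Δ l G)) i                  ≡⟨ shift-cong 1 (Δ₁^-Δ n l G) i ⟩
  shift 1 (Δ l (Δ₁^ n G)) i                  ≡⟨ shift-cong 1 (Δ-cong l (Δ₁^-compositionSeries ls)) i ⟩
  shift 1 (Δ l (shift n (∏1-x^ ls))) i       ≡⟨ shift-cong 1 (Δ-shift l n (∏1-x^ ls)) i ⟩
  shift 1 (shift n (∏1-x^ (l ∷ ls))) i       ≡⟨ shift-shift 1 n (∏1-x^ (l ∷ ls)) i ⟩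
  shift (suc n) (∏1-x^ (l ∷ ls)) i           ∎
  where
  open ≡-Reasoning
  n : ℕ
  n = length ls
  G : Seq
  G = compositionSeries ls

boundedCompositions-injective : ∀ {as bs} → Linked _≥_ as → Linked _≥_ bs → All (1 ≤_) as → All (1 ≤_) bs →
  length as ≡ length bs → boundedCompositions as 0 ≗ boundedCompositions bs 0 → as ≡ bs
boundedCompositions-injective {as} {bs} ↘as ↘bs 1≤as 1≤bs |as|≡|bs| e =
  ∏1-x^-injective-↘ ↘as ↘bs 1≤as 1≤bs (shift-injective (length as) (λ i → begin
    shift (length as) (∏1-x^ as) i             ≡⟨ Δ₁^-compositionSeries as i ⟨
    Δ₁^ (length as) (compositionSeries as) i   ≡⟨ Δ₁^-cong (length as) (cong +_ ∘ e) i ⟩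
    Δ₁^ (length as) (compositionSeries bs) i   ≡⟨ cong (λ n → Δ₁^ n (compositionSeries bs) i) |as|≡|bs| ⟩
    Δ₁^ (length bs) (compositionSeries bs) i   ≡⟨ Δ₁^-compositionSeries bs i ⟩
    shift (length bs) (∏1-x^ bs) i             ≡⟨ cong (λ n → shift n (∏1-x^ bs) i) |as|≡|bs| ⟨
    shift (length as) (∏1-x^ bs) i             ∎))
  where open ≡-Reasoning

-- A single leg

range : ℕ → ℕ → List ℕ
range a zero    = []
range a (suc m) = a ∷ range (suc a) m

range-++ : ∀ a l m → range a (l + m) ≡ range a l ++ range (a + l) m
range-++ a zero    m rewrite +-identityʳ a = refl
range-++ a (suc l) m rewrite range-++ (suc a) l m | +-suc a l = refl

range-bounds : ∀ a m → All (λ v → a ≤ v × v < a + m) (range a m)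
range-bounds a zero    = []
range-bounds a (suc m) = (≤-refl , ≤-<-trans (m≤m+n a m) (≤-reflexive (sym (+-suc a m))))
  ∷ All.map (λ (a<v , v<) → <⇒≤ a<v , <-≤-trans v< (≤-reflexive (sym (+-suc a m)))) (range-bounds (suc a) m)

length-range : ∀ a m → length (range a m) ≡ m
length-range a zero    = refl
length-range a (suc m) = cong suc (length-range (suc a) m)

touches : List Edge → ℕ → Bool
touches S v = not (degree S v ≡ᵇ 0)

covered : ℕ → ℕ → List Edge → ℕ
covered c l s = countᵇ (touches s) (range c l)

-- The leaf-edge test of Defs for an edge of s, except that the vertex p is taken to have
-- degree D: for a part s of a subtree, D is the degree of p in the whole subtree.
leafEdgeWithᵇ : ℕ → ℕ → List Edge → Edge → Bool
leafEdgeWithᵇ p D s (a , b) = (if a ≡ᵇ p then D ≡ᵇ 1 else degree s a ≡ᵇ 1) ∨ (degree s b ≡ᵇ 1)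

leafEdgesWith : ℕ → ℕ → List Edge → ℕ
leafEdgesWith p D s = countᵇ (leafEdgeWithᵇ p D s) s

LegEdge : ℕ → ℕ → ℕ → Edge → Set
LegEdge p c l (a , b) = (a ≡ p ⊎ (c ≤ a × a < c + l)) × (c ≤ b × b < c + l)

legEdges-shape : ∀ p c l → All (LegEdge p c l) (legEdges p c l)
legEdges-shape p c zero    = []
legEdges-shape p c (suc l) = (inj₁ refl , ≤-refl , c<c+1+l) ∷ All.map widen (legEdges-shape c (suc c) l)
  where
  c+1+l≡ : suc c + l ≡ c + suc l
  c+1+l≡ = sym (+-suc c l)
  c<c+1+l : c < c + suc l
  c<c+1+l = ≤-<-trans (m≤m+n c l) (≤-reflexive c+1+l≡)
  widen : ∀ {e} → LegEdge c (suc c) l e → LegEdge p c (suc l) e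
  widen (inj₁ refl , c<b , b<) = inj₂ (≤-refl , c<c+1+l) , <⇒≤ c<b , <-≤-trans b< (≤-reflexive c+1+l≡)
  widen (inj₂ (c<a , a<) , c<b , b<) =
    inj₂ (<⇒≤ c<a , <-≤-trans a< (≤-reflexive c+1+l≡)) , <⇒≤ c<b , <-≤-trans b< (≤-reflexive c+1+l≡)

⊆-legEdges-shape : ∀ {p c l s} → s ⊆ legEdges p c l → All (LegEdge p c l) s
⊆-legEdges-shape {p} {c} {l} s⊆ = All-resp-⊆ s⊆ (legEdges-shape p c l)

incident-false : ∀ {v a b} → v ≢ a → v ≢ b → incident v (a , b) ≡ false
incident-false v≢a v≢b rewrite ≢⇒≡ᵇ-false v≢a | ≢⇒≡ᵇ-false v≢b = refl

degree-∷-start : ∀ {p c} s → degree ((p , c) ∷ s) p ≡ suc (degree s p)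
degree-∷-start {p} s rewrite ≡ᵇ-refl p = refl

degree-∷-end : ∀ {p c} s → degree ((p , c) ∷ s) c ≡ suc (degree s c)
degree-∷-end {p} {c} s rewrite ≡ᵇ-refl c | ∨-zeroʳ (c ≡ᵇ p) = refl

degree-∷-beyond : ∀ {p c v} s → p < c → c < v → degree ((p , c) ∷ s) v ≡ degree s v
degree-∷-beyond s p<c c<v rewrite incident-false (>⇒≢ (<-trans p<c c<v)) (>⇒≢ c<v) = refl

degree-legStart : ∀ {c l s} → s ⊆ legEdges c (suc c) l → ∀ {v} → v < c → degree s v ≡ 0
degree-legStart {c} {l} s⊆ {v} v<c = countᵇ-none (All.map untouched (⊆-legEdges-shape s⊆))
  where
  untouched : ∀ {e} → LegEdge c (suc c) l e → incident v e ≡ false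
  untouched (inj₁ refl , c<b , _)      = incident-false (<⇒≢ v<c) (<⇒≢ (<-trans v<c c<b))
  untouched (inj₂ (c<a , _) , c<b , _) = incident-false (<⇒≢ (<-trans v<c c<a)) (<⇒≢ (<-trans v<c c<b))

covered-suc : ∀ c l s → covered c (suc l) s ≡ when (touches s c) 1 + covered (suc c) l s
covered-suc c l s with touches s c
... | true  = refl
... | false = refl

covered-∷ : ∀ {p c} l s → p < c → covered c (suc l) ((p , c) ∷ s) ≡ suc (covered (suc c) l s)
covered-∷ {p} {c} l s p<c rewrite covered-suc c l ((p , c) ∷ s) | degree-∷-end {p} {c} s =
  cong suc (countᵇ-cong (All.map (λ (c<v , _) → cong (λ d → not (d ≡ᵇ 0)) (degree-∷-beyond s p<c c<v))
                                 (range-bounds (suc c) l)))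

covered-[] : ∀ c l → covered c l [] ≡ 0
covered-[] c zero    = refl
covered-[] c (suc l) = covered-[] (suc c) l

leafEdgeWithᵇ-∷ : ∀ {p c l D} s → p < c → ∀ {e} → LegEdge c (suc c) l e →
  leafEdgeWithᵇ p D ((p , c) ∷ s) e ≡ leafEdgeWithᵇ c (suc (degree s c)) s e
leafEdgeWithᵇ-∷ {p} {c} s p<c {_ , b} (inj₁ refl , c<b , _)
  rewrite degree-∷-end {p} {c} s | degree-∷-beyond s p<c c<b | ≢⇒≡ᵇ-false (>⇒≢ p<c) | ≡ᵇ-refl c = refl
leafEdgeWithᵇ-∷ {p} {c} s p<c {a , b} (inj₂ (c<a , _) , c<b , _)
  rewrite degree-∷-beyond s p<c c<a | degree-∷-beyond s p<c c<b
        | ≢⇒≡ᵇ-false (>⇒≢ (<-trans p<c c<a)) | ≢⇒≡ᵇ-false (>⇒≢ c<a) = refl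

leafEdgeWithᵇ-∷ʳ : ∀ {p c l D} s → p < c → ∀ {e} → LegEdge c (suc c) l e →
  leafEdgeWithᵇ p D s e ≡ leafEdgeWithᵇ c (degree s c) s e
leafEdgeWithᵇ-∷ʳ {p} {c} s p<c (inj₁ refl , _) rewrite ≢⇒≡ᵇ-false (>⇒≢ p<c) | ≡ᵇ-refl c = refl
leafEdgeWithᵇ-∷ʳ {p} {c} s p<c (inj₂ (c<a , _) , _)
  rewrite ≢⇒≡ᵇ-false (>⇒≢ (<-trans p<c c<a)) | ≢⇒≡ᵇ-false (>⇒≢ c<a) = refl

leafEdgesWith-∷ : ∀ {p c l D s} → s ⊆ legEdges c (suc c) l → p < c →
  leafEdgesWith p D ((p , c) ∷ s) ≡ when ((D ≡ᵇ 1) ∨ (degree s c ≡ᵇ 0)) 1 + leafEdgesWith c (suc (degree s c)) s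
leafEdgesWith-∷ {p} {c} {l} {D} {s} s⊆ p<c rewrite ≡ᵇ-refl p | degree-∷-end {p} {c} s
  with (D ≡ᵇ 1) ∨ (degree s c ≡ᵇ 0)
... | true  = cong suc (countᵇ-cong (All.map (leafEdgeWithᵇ-∷ {D = D} s p<c) (⊆-legEdges-shape s⊆)))
... | false = countᵇ-cong (All.map (leafEdgeWithᵇ-∷ {D = D} s p<c) (⊆-legEdges-shape s⊆))

leafEdgesWith-∷ʳ : ∀ {p c l D s} → s ⊆ legEdges c (suc c) l → p < c →
  leafEdgesWith p D s ≡ leafEdgesWith c (degree s c) s
leafEdgesWith-∷ʳ {D = D} {s} s⊆ p<c = countᵇ-cong (All.map (leafEdgeWithᵇ-∷ʳ {D = D} s p<c) (⊆-legEdges-shape s⊆))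

≤1⇒≡0⊎≡1 : ∀ {x} → x ≤ 1 → x ≡ 0 ⊎ x ≡ 1
≤1⇒≡0⊎≡1 z≤n       = inj₁ refl
≤1⇒≡0⊎≡1 (s≤s z≤n) = inj₂ refl

degree-start≤1 : ∀ {p c l s} → s ⊆ legEdges p c l → p < c → degree s p ≤ 1
degree-start≤1 {l = zero} [] _ = z≤n
degree-start≤1 {p} {c} {suc l} {_ ∷ s} (refl ∷ s⊆) p<c rewrite degree-∷-start {p} {c} s | degree-legStart s⊆ p<c = s≤s z≤n
degree-start≤1 {p} {c} {suc l} (_ ∷ʳ s⊆) p<c rewrite degree-legStart s⊆ p<c = z≤n

length≤covered : ∀ {p c l s} → s ⊆ legEdges p c l → p < c → length s ≤ covered c l s
length≤covered {l = zero} [] _ = z≤n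
length≤covered {p} {c} {suc l} {_ ∷ s} (refl ∷ s⊆) p<c rewrite covered-∷ l s p<c = s≤s (length≤covered s⊆ (n<1+n c))
length≤covered {p} {c} {suc l} {s} (_ ∷ʳ s⊆) p<c rewrite covered-suc c l s =
  ≤-trans (length≤covered s⊆ (n<1+n c)) (m≤n+m _ _)

-- Every component of s not containing p covers one vertex more than it has edges.
covered≡length⇒[] : ∀ {p c l s} → s ⊆ legEdges p c l → p < c →
  covered c l s ≡ length s → degree s p ≡ 0 → s ≡ []
covered≡length⇒[] {l = zero} [] _ _ _ = refl
covered≡length⇒[] {p} {c} {suc l} {_ ∷ s} (refl ∷ s⊆) p<c _ deg≡0 rewrite degree-∷-start {p} {c} s with deg≡0
... | ()
covered≡length⇒[] {p} {c} {suc l} {s} (_ ∷ʳ s⊆) p<c cov≡ _ with degree s c in deg≡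
... | zero  = covered≡length⇒[] s⊆ (n<1+n c) cov≡ deg≡
... | suc _ = contradiction (s≤s (length≤covered s⊆ (n<1+n c))) (<-irrefl (sym cov≡))

when-0 : ∀ b → when b 0 ≡ 0
when-0 true  = refl
when-0 false = refl

-- A component of s has at most two leaf edges, and only one if it contains p while D ≢ 1;
-- the bound adds this up against the count "vertices = edges + 1" for each component.
leafEdgesWith-bound : ∀ {p c l D s} → s ⊆ legEdges p c l → p < c →
  leafEdgesWith p D s + (length s + length s) ≤ (covered c l s + covered c l s) + degree s p + when (D ≡ᵇ 1) (degree s p)
leafEdgesWith-bound {l = zero} [] _ = z≤n
leafEdgesWith-bound {p} {c} {suc l} {D} {_ ∷ s} (refl ∷ s⊆) p<c
  rewrite leafEdgesWith-∷ {p} {c} {l} {D} {s} s⊆ p<c | covered-∷ l s p<c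
        | degree-∷-start {p} {c} s | degree-legStart s⊆ p<c =
  combine (when ((D ≡ᵇ 1) ∨ (degree s c ≡ᵇ 0)) 1) (leafEdgesWith c (suc (degree s c)) s) (length s)
          (covered (suc c) l s) (degree s c) (when (suc (degree s c) ≡ᵇ 1) (degree s c)) (when (D ≡ᵇ 1) 1)
          (leafEdgesWith-bound {D = suc (degree s c)} s⊆ (n<1+n c))
          (firstEdge (≤1⇒≡0⊎≡1 (degree-start≤1 s⊆ (n<1+n c))) (D ≡ᵇ 1))
  where
  firstEdge : ∀ {f} → f ≡ 0 ⊎ f ≡ 1 → ∀ b → when (b ∨ (f ≡ᵇ 0)) 1 + (f + when (suc f ≡ᵇ 1) f) ≤ 1 + when b 1
  firstEdge (inj₁ refl) true  = s≤s z≤n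
  firstEdge (inj₁ refl) false = ≤-refl
  firstEdge (inj₂ refl) true  = ≤-refl
  firstEdge (inj₂ refl) false = ≤-refl
  combine : ∀ h L x n f g d → L + (x + x) ≤ (n + n) + f + g → h + (f + g) ≤ 1 + d →
    h + L + (suc x + suc x) ≤ (suc n + suc n) + 1 + d
  combine h L x n f g d ih first = begin
    h + L + (suc x + suc x)         ≡⟨ solve 3 (λ h L x → h :+ L :+ ((con 1 :+ x) :+ (con 1 :+ x))
                                                   := (h :+ con 2) :+ (L :+ (x :+ x))) refl h L x ⟩
    (h + 2) + (L + (x + x))         ≤⟨ +-monoʳ-≤ (h + 2) ih ⟩
    (h + 2) + ((n + n) + f + g)     ≡⟨ solve 4 (λ h n f g → (h :+ con 2) :+ ((n :+ n) :+ f :+ g)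
                                                   := (h :+ (f :+ g)) :+ (con 2 :+ (n :+ n))) refl h n f g ⟩
    (h + (f + g)) + (2 + (n + n))   ≤⟨ +-monoˡ-≤ (2 + (n + n)) first ⟩
    (1 + d) + (2 + (n + n))         ≡⟨ solve 2 (λ n d → (con 1 :+ d) :+ (con 2 :+ (n :+ n))
                                                   := ((con 1 :+ n) :+ (con 1 :+ n)) :+ con 1 :+ d) refl n d ⟩
    (suc n + suc n) + 1 + d         ∎
    where
    open ≤-Reasoning
    open ℕ-Solver.+-*-Solver
leafEdgesWith-bound {p} {c} {suc l} {D} {s} (_ ∷ʳ s⊆) p<c
  rewrite leafEdgesWith-∷ʳ {p} {c} {l} {D} {s} s⊆ p<c | covered-suc c l s
        | degree-legStart s⊆ p<c | when-0 (D ≡ᵇ 1) =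
  skipped (≤1⇒≡0⊎≡1 (degree-start≤1 s⊆ (n<1+n c))) (leafEdgesWith-bound {D = degree s c} s⊆ (n<1+n c))
  where
  open ℕ-Solver.+-*-Solver
  L n : ℕ
  L = leafEdgesWith c (degree s c) s
  n = covered (suc c) l s
  skipped : ∀ {f} → f ≡ 0 ⊎ f ≡ 1 → L + (length s + length s) ≤ (n + n) + f + when (f ≡ᵇ 1) f →
    L + (length s + length s) ≤ (when (not (f ≡ᵇ 0)) 1 + n + (when (not (f ≡ᵇ 0)) 1 + n)) + 0 + 0
  skipped (inj₁ refl) ih = ih
  skipped (inj₂ refl) ih = ≤-trans ih (≤-reflexive (solve 1 (λ n → (n :+ n) :+ con 1 :+ con 1
                                                      := (con 1 :+ n :+ (con 1 :+ n)) :+ con 0 :+ con 0) refl n))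

leafEdgesWith-initialSegment : ∀ {p c l D s} → s ⊆ legEdges p c l → p < c →
  covered c l s ≡ length s → degree s p ≡ 1 → (D ≡ᵇ 1) ≡ false → leafEdgesWith p D s ≡ 1
leafEdgesWith-initialSegment {p} {c} {suc l} {D} {_ ∷ s} (refl ∷ s⊆) p<c cov≡ _ D≢1
  rewrite leafEdgesWith-∷ {p} {c} {l} {D} {s} s⊆ p<c | D≢1 =
  rest (≤1⇒≡0⊎≡1 (degree-start≤1 s⊆ (n<1+n c))) refl (suc-injective (trans (sym (covered-∷ l s p<c)) cov≡))
  where
  rest : ∀ {f} → f ≡ 0 ⊎ f ≡ 1 → degree s c ≡ f → covered (suc c) l s ≡ length s →
    when (false ∨ (f ≡ᵇ 0)) 1 + leafEdgesWith c (suc f) s ≡ 1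
  rest (inj₁ refl) deg≡0 cov≡′ rewrite covered≡length⇒[] s⊆ (n<1+n c) cov≡′ deg≡0 = refl
  rest (inj₂ refl) deg≡1 cov≡′ = leafEdgesWith-initialSegment {D = 2} s⊆ (n<1+n c) cov≡′ deg≡1 refl
leafEdgesWith-initialSegment {p} {c} {suc l} (_ ∷ʳ s⊆) p<c _ deg≡1 _ rewrite degree-legStart s⊆ p<c with deg≡1
... | ()

sum-sublists-[] : ∀ {A : Set} (F : List A → ℕ) xs → (∀ {y ys} → y ∷ ys ⊆ xs → F (y ∷ ys) ≡ 0) →
  sum (map F (sublists xs)) ≡ F []
sum-sublists-[] F []       _       = +-identityʳ (F [])
sum-sublists-[] F (x ∷ xs) F≡0 = trans (sum-sublists-∷ F x xs) (cong₂ _+_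
  (sum-map-zero (All.map (λ ys⊆ → F≡0 (refl ∷ ys⊆)) (sublists-⊆ xs)))
  (sum-sublists-[] F xs (λ ys⊆ → F≡0 (x ∷ʳ ys⊆))))

-- The sublists s with covered c l s ≡ length s are the initial segments of the leg,
-- one of each length.
∑-initialSegments : ∀ {p c} l (g : ℕ → ℕ) → p < c →
  sum (map (λ s → when (covered c l s ≡ᵇ length s) (g (length s))) (sublists (legEdges p c l))) ≡ ∑ (suc l) g
∑-initialSegments zero g _ = refl
∑-initialSegments {p} {c} (suc l) g p<c = begin
  sum (map F (sublists ((p , c) ∷ leg)))
    ≡⟨ sum-sublists-∷ F (p , c) leg ⟩
  sum (map (F ∘ ((p , c) ∷_)) (sublists leg)) + sum (map F (sublists leg))
    ≡⟨ cong₂ _+_ (trans (sum-map-cong (All.map first (sublists-⊆ leg))) (∑-initialSegments l (g ∘ suc) (n<1+n c)))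
                 (trans (sum-sublists-[] F leg notFirst) (cong (λ n → when (n ≡ᵇ 0) (g 0)) (covered-[] c (suc l)))) ⟩
  ∑ (suc l) (g ∘ suc) + g 0
    ≡⟨ +-comm _ (g 0) ⟩
  ∑ (suc (suc l)) g ∎
  where
  open ≡-Reasoning
  leg : List Edge
  leg = legEdges c (suc c) l
  F : List Edge → ℕ
  F s = when (covered c (suc l) s ≡ᵇ length s) (g (length s))
  first : ∀ {s} → s ⊆ leg → F ((p , c) ∷ s) ≡ when (covered (suc c) l s ≡ᵇ length s) (g (suc (length s)))
  first {s} _ rewrite covered-∷ l s p<c = refl
  notFirst : ∀ {y ys} → y ∷ ys ⊆ leg → F (y ∷ ys) ≡ 0
  notFirst {y} {ys} ys⊆ with covered c (suc l) (y ∷ ys) ≡ᵇ length (y ∷ ys) in cov≡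
  ... | false = refl
  ... | true with covered≡length⇒[] ((p , c) ∷ʳ ys⊆) p<c (≡ᵇ-true⇒≡ cov≡) (degree-legStart ys⊆ p<c)
  ...   | ()

∑-nonemptyInitialSegments : ∀ {p c} l (g : ℕ → ℕ) → p < c →
  sum (map (λ s → when ((covered c l s ≡ᵇ length s) ∧ (degree s p ≡ᵇ 1)) (g (length s))) (sublists (legEdges p c l)))
    ≡ ∑ l (g ∘ suc)
∑-nonemptyInitialSegments zero g _ = refl
∑-nonemptyInitialSegments {p} {c} (suc l) g p<c = begin
  sum (map F (sublists ((p , c) ∷ leg)))
    ≡⟨ sum-sublists-∷ F (p , c) leg ⟩
  sum (map (F ∘ ((p , c) ∷_)) (sublists leg)) + sum (map F (sublists leg))
    ≡⟨ cong₂ _+_ (trans (sum-map-cong (All.map first (sublists-⊆ leg))) (∑-initialSegments l (g ∘ suc) (n<1+n c)))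
                 (sum-map-zero (All.map notFirst (sublists-⊆ leg))) ⟩
  ∑ (suc l) (g ∘ suc) + 0
    ≡⟨ +-identityʳ _ ⟩
  ∑ (suc l) (g ∘ suc) ∎
  where
  open ≡-Reasoning
  leg : List Edge
  leg = legEdges c (suc c) l
  F : List Edge → ℕ
  F s = when ((covered c (suc l) s ≡ᵇ length s) ∧ (degree s p ≡ᵇ 1)) (g (length s))
  first : ∀ {s} → s ⊆ leg → F ((p , c) ∷ s) ≡ when (covered (suc c) l s ≡ᵇ length s) (g (suc (length s)))
  first {s} s⊆ rewrite covered-∷ l s p<c | degree-∷-start {p} {c} s | degree-legStart s⊆ p<c
    | ∧-identityʳ (covered (suc c) l s ≡ᵇ length s) = refl
  notFirst : ∀ {s} → s ⊆ leg → F s ≡ 0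
  notFirst {s} s⊆ rewrite degree-legStart s⊆ p<c | ∧-zeroʳ (covered c (suc l) s ≡ᵇ length s) = refl

-- Splitting a subtree along the legs

LegEdge-mono : ∀ {p c l c′ l′ e} → c′ ≤ c → c + l ≤ c′ + l′ → LegEdge p c l e → LegEdge p c′ l′ e
LegEdge-mono c′≤c bound (start , c≤b , b<) =
  Sum.map₂ (λ (c≤a , a<) → ≤-trans c′≤c c≤a , <-≤-trans a< bound) start , ≤-trans c′≤c c≤b , <-≤-trans b< bound

-- The first leg starts at vertex suc c.
data LegSplit : ℕ → List ℕ → List Edge → Set where
  []  : ∀ {c} → LegSplit c [] []
  _∷_ : ∀ {c l ls s t} → s ⊆ legEdges 0 (suc c) l → LegSplit (c + l) ls t → LegSplit c (l ∷ ls) (s ++ t)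

legSplit : ∀ c ls {S} → S ⊆ spiderEdges′ (suc c) ls → LegSplit c ls S
legSplit c []       []  = []
legSplit c (l ∷ ls) S⊆ with ⊆-++-split (legEdges 0 (suc c) l) (spiderEdges′ (suc (c + l)) ls) S⊆
... | s , t , refl , s⊆ , t⊆ = s⊆ ∷ legSplit (c + l) ls t⊆

legSplit-shape : ∀ {c ls S} → LegSplit c ls S → All (LegEdge 0 (suc c) (sum ls)) S
legSplit-shape []                       = []
legSplit-shape (_∷_ {c} {l} {ls} s⊆ sp) =
  All.++⁺ (All.map (LegEdge-mono ≤-refl (+-monoʳ-≤ (suc c) (m≤m+n l (sum ls)))) (⊆-legEdges-shape s⊆))
          (All.map (LegEdge-mono (s≤s (m≤m+n c l)) (≤-reflexive (cong suc (+-assoc c l (sum ls))))) (legSplit-shape sp))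

legSum : ∀ {c ls S} → (ℕ → ℕ → List Edge → ℕ) → LegSplit c ls S → ℕ
legSum f []                       = 0
legSum f (_∷_ {c} {l} {s = s} _ sp) = f (suc c) l s + legSum f sp

edgesOnLegs coveredOnLegs torsoDegreeOnLegs : ∀ {c ls S} → LegSplit c ls S → ℕ
edgesOnLegs       = legSum (λ _ _ → length)
coveredOnLegs     = legSum covered
torsoDegreeOnLegs = legSum (λ _ _ s → degree s 0)

leafEdgesOnLegs : ℕ → ∀ {c ls S} → LegSplit c ls S → ℕ
leafEdgesOnLegs D = legSum (λ _ _ → leafEdgesWith 0 D)

edgesOnLegs≡length : ∀ {c ls S} (sp : LegSplit c ls S) → edgesOnLegs sp ≡ length S
edgesOnLegs≡length []                 = refl
edgesOnLegs≡length (_∷_ {s = s} _ sp) = trans (cong (_+_ (length s)) (edgesOnLegs≡length sp)) (sym (length-++ s))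

torsoDegreeOnLegs≡degree : ∀ {c ls S} (sp : LegSplit c ls S) → torsoDegreeOnLegs sp ≡ degree S 0
torsoDegreeOnLegs≡degree []                         = refl
torsoDegreeOnLegs≡degree (_∷_ {s = s} {t} _ sp) =
  trans (cong (_+_ (degree s 0)) (torsoDegreeOnLegs≡degree sp)) (sym (countᵇ-++ (incident 0) s t))

degree-outside : ∀ {c l v s} → All (LegEdge 0 c l) s → v ≢ 0 → v < c ⊎ c + l ≤ v → degree s v ≡ 0
degree-outside {c} {l} {v} shape v≢0 outside = countᵇ-none (All.map untouched shape)
  where
  apart : ∀ {x} → c ≤ x → x < c + l → v ≢ x
  apart c≤x x< = Sum.[ (λ v<c → <⇒≢ (<-≤-trans v<c c≤x)) , (λ c+l≤v → >⇒≢ (<-≤-trans x< c+l≤v)) ] outside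
  untouched : ∀ {e} → LegEdge 0 c l e → incident v e ≡ false
  untouched (inj₁ refl , c≤b , b<)        = incident-false v≢0 (apart c≤b b<)
  untouched (inj₂ (c≤a , a<) , c≤b , b<) = incident-false (apart c≤a a<) (apart c≤b b<)

-- W is the whole subtree; along the recursion over the legs, S is its part on the remaining legs.
module _ {W : List Edge} where

  degree-onLeg : ∀ {c l ls s t} → LegSplit (c + l) ls t → (∀ {v} → c < v → degree W v ≡ degree (s ++ t) v) →
    ∀ {v} → c < v → v < suc c + l → degree W v ≡ degree s v
  degree-onLeg {s = s} {t} sp agree {v} c<v v< = begin
    degree W v                ≡⟨ agree c<v ⟩
    degree (s ++ t) v         ≡⟨ countᵇ-++ (incident v) s t ⟩
    degree s v + degree t v
      ≡⟨ cong (_+_ (degree s v)) (degree-outside (legSplit-shape sp) (>⇒≢ (<-≤-trans z<s c<v)) (inj₁ v<)) ⟩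
    degree s v + 0            ≡⟨ +-identityʳ _ ⟩
    degree s v                ∎
    where open ≡-Reasoning

  degree-pastLeg : ∀ {c l s t} → s ⊆ legEdges 0 (suc c) l → (∀ {v} → c < v → degree W v ≡ degree (s ++ t) v) →
    ∀ {v} → c + l < v → degree W v ≡ degree t v
  degree-pastLeg {c} {l} {s} {t} s⊆ agree {v} c+l<v = begin
    degree W v                ≡⟨ agree (<-≤-trans (s≤s (m≤m+n c l)) c+l<v) ⟩
    degree (s ++ t) v         ≡⟨ countᵇ-++ (incident v) s t ⟩
    degree s v + degree t v
      ≡⟨ cong (_+ degree t v) (degree-outside (⊆-legEdges-shape s⊆) (>⇒≢ (<-≤-trans z<s c+l<v)) (inj₂ c+l<v)) ⟩
    degree t v                ∎
    where open ≡-Reasoning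

  covered-onLegs : ∀ {c ls S} (sp : LegSplit c ls S) → (∀ {v} → c < v → degree W v ≡ degree S v) →
    countᵇ (touches W) (range (suc c) (sum ls)) ≡ coveredOnLegs sp
  covered-onLegs [] _ = refl
  covered-onLegs (_∷_ {c} {l} {ls} {s} s⊆ sp) agree rewrite range-++ (suc c) l (sum ls) =
    trans (countᵇ-++ (touches W) (range (suc c) l) (range (suc c + l) (sum ls)))
          (cong₂ _+_ (countᵇ-cong (All.map (λ (c<v , v<) → cong (λ d → not (d ≡ᵇ 0)) (degree-onLeg {s = s} sp agree c<v v<))
                                           (range-bounds (suc c) l)))
                     (covered-onLegs sp (degree-pastLeg s⊆ agree)))

  leafEdges-onLegs : ∀ {c ls S} (sp : LegSplit c ls S) → (∀ {v} → c < v → degree W v ≡ degree S v) →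
    countᵇ (leafEdgeᵇ W) S ≡ leafEdgesOnLegs (degree W 0) sp
  leafEdges-onLegs [] _ = refl
  leafEdges-onLegs (_∷_ {c} {l} {ls} {s} {t} s⊆ sp) agree =
    trans (countᵇ-++ (leafEdgeᵇ W) s t)
          (cong₂ _+_ (countᵇ-cong (All.map sameTest (⊆-legEdges-shape s⊆))) (leafEdges-onLegs sp (degree-pastLeg s⊆ agree)))
    where
    sameTest : ∀ {e} → LegEdge 0 (suc c) l e → leafEdgeᵇ W e ≡ leafEdgeWithᵇ 0 (degree W 0) s e
    sameTest (inj₁ refl , c<b , b<) rewrite degree-onLeg {s = s} sp agree c<b b< = refl
    sameTest {a , _} (inj₂ (c<a , a<) , c<b , b<)
      rewrite degree-onLeg {s = s} sp agree c<b b< | degree-onLeg {s = s} sp agree c<a a<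
            | ≢⇒≡ᵇ-false (>⇒≢ (<-≤-trans z<s c<a)) = refl

-- For s ⊆ legEdges 0 c l with c ≥ 1 this holds iff s is a nonempty initial segment of the leg.
legSegmentᵇ : ℕ → ℕ → List Edge → Bool
legSegmentᵇ c l s = (covered c l s ≡ᵇ length s) ∧ (degree s 0 ≡ᵇ 1)

legSegmentsᵇ : ℕ → List ℕ → List Edge → Bool
legSegmentsᵇ c []       S = true
legSegmentsᵇ c (l ∷ ls) S = legSegmentᵇ (suc c) l (filter (λ e → proj₂ e ≤? c + l) S)
                          ∧ legSegmentsᵇ (c + l) ls (filter (λ e → c + l <? proj₂ e) S)

legSegmentsᵇ-∷ : ∀ {c l ls s t} → s ⊆ legEdges 0 (suc c) l → LegSplit (c + l) ls t →
  legSegmentsᵇ c (l ∷ ls) (s ++ t) ≡ legSegmentᵇ (suc c) l s ∧ legSegmentsᵇ (c + l) ls t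
legSegmentsᵇ-∷ {c} {l} {ls} {s} {t} s⊆ sp
  rewrite filter-++ (λ e → proj₂ e ≤? c + l) s t | filter-++ (λ e → c + l <? proj₂ e) s t
        | filter-all (λ e → proj₂ e ≤? c + l) (All.map (λ (_ , _ , b<) → ≤-pred b<) (⊆-legEdges-shape s⊆))
        | filter-none (λ e → proj₂ e ≤? c + l) (All.map (λ (_ , c+l<b , _) → <⇒≱ c+l<b) (legSplit-shape sp))
        | filter-none (λ e → c + l <? proj₂ e) (All.map (λ (_ , _ , b<) → ≤⇒≯ (≤-pred b<)) (⊆-legEdges-shape s⊆))
        | filter-all (λ e → c + l <? proj₂ e) (All.map (λ (_ , c+l<b , _) → c+l<b) (legSplit-shape sp))
        | ++-identityʳ s = refl

legSegmentsᵇ-∷-true : ∀ {c l ls s t} → s ⊆ legEdges 0 (suc c) l → LegSplit (c + l) ls t →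
  legSegmentsᵇ c (l ∷ ls) (s ++ t) ≡ true →
  covered (suc c) l s ≡ length s × degree s 0 ≡ 1 × legSegmentsᵇ (c + l) ls t ≡ true
legSegmentsᵇ-∷-true s⊆ sp segs rewrite legSegmentsᵇ-∷ s⊆ sp with ∧-true segs
... | seg , segs′ with ∧-true seg
...   | cov≡ , deg≡ = ≡ᵇ-true⇒≡ cov≡ , ≡ᵇ-true⇒≡ deg≡ , segs′

when-1 : ∀ {b} → when b 1 ≡ 1 → b ≡ true
when-1 {true} _ = refl

when-+ : ∀ b x y → when b (x + y) ≡ when b x + when b y
when-+ true  x y = refl
when-+ false x y = refl

leafEdgesOnLegs-bound : ∀ {c ls S} (sp : LegSplit c ls S) D →
  leafEdgesOnLegs D sp + (edgesOnLegs sp + edgesOnLegs sp)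
    ≤ (coveredOnLegs sp + coveredOnLegs sp) + torsoDegreeOnLegs sp + when (D ≡ᵇ 1) (torsoDegreeOnLegs sp)
leafEdgesOnLegs-bound []                   D = z≤n
leafEdgesOnLegs-bound (_∷_ {c} {l} {s = s} s⊆ sp) D rewrite when-+ (D ≡ᵇ 1) (degree s 0) (torsoDegreeOnLegs sp) =
  add (leafEdgesWith 0 D s) (length s) (covered (suc c) l s) (degree s 0) (when (D ≡ᵇ 1) (degree s 0))
      (leafEdgesOnLegs D sp) (edgesOnLegs sp) (coveredOnLegs sp) (torsoDegreeOnLegs sp) (when (D ≡ᵇ 1) (torsoDegreeOnLegs sp))
      (leafEdgesWith-bound {D = D} s⊆ z<s) (leafEdgesOnLegs-bound sp D)
  where
  add : ∀ a x n f g a′ x′ n′ f′ g′ → a + (x + x) ≤ (n + n) + f + g → a′ + (x′ + x′) ≤ (n′ + n′) + f′ + g′ →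
    (a + a′) + ((x + x′) + (x + x′)) ≤ ((n + n′) + (n + n′)) + (f + f′) + (g + g′)
  add a x n f g a′ x′ n′ f′ g′ bound bound′ = begin
    (a + a′) + ((x + x′) + (x + x′))               ≡⟨ solve 4 (λ a x a′ x′ → (a :+ a′) :+ ((x :+ x′) :+ (x :+ x′))
                                                        := (a :+ (x :+ x)) :+ (a′ :+ (x′ :+ x′))) refl a x a′ x′ ⟩
    (a + (x + x)) + (a′ + (x′ + x′))               ≤⟨ +-mono-≤ bound bound′ ⟩
    ((n + n) + f + g) + ((n′ + n′) + f′ + g′)      ≡⟨ solve 6 (λ n f g n′ f′ g′ → ((n :+ n) :+ f :+ g) :+ ((n′ :+ n′) :+ f′ :+ g′)
                                                        := ((n :+ n′) :+ (n :+ n′)) :+ (f :+ f′) :+ (g :+ g′)) refl n f g n′ f′ g′ ⟩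
    ((n + n′) + (n + n′)) + (f + f′) + (g + g′)    ∎
    where
    open ≤-Reasoning
    open ℕ-Solver.+-*-Solver

edgesOnLegs≤coveredOnLegs : ∀ {c ls S} (sp : LegSplit c ls S) → edgesOnLegs sp ≤ coveredOnLegs sp
edgesOnLegs≤coveredOnLegs []          = z≤n
edgesOnLegs≤coveredOnLegs (s⊆ ∷ sp) = +-mono-≤ (length≤covered s⊆ z<s) (edgesOnLegs≤coveredOnLegs sp)

torsoDegreeOnLegs≤legs : ∀ {c ls S} (sp : LegSplit c ls S) → torsoDegreeOnLegs sp ≤ length ls
torsoDegreeOnLegs≤legs []          = z≤n
torsoDegreeOnLegs≤legs (s⊆ ∷ sp) = +-mono-≤ (degree-start≤1 s⊆ z<s) (torsoDegreeOnLegs≤legs sp)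

≤-+-tight : ∀ {a b c d} → a ≤ b → c ≤ d → a + c ≡ b + d → a ≡ b × c ≡ d
≤-+-tight {a} {b} {c} {d} a≤b c≤d sum≡ = a≡b , c≡d
  where
  a≡b : a ≡ b
  a≡b = ≤-antisym a≤b (+-cancelʳ-≤ d b a (≤-trans (≤-reflexive (sym sum≡)) (+-monoʳ-≤ a c≤d)))
  c≡d : c ≡ d
  c≡d = +-cancelˡ-≡ b c d (trans (cong (_+ c) (sym a≡b)) sum≡)

legSegments-intro : ∀ {c ls S} (sp : LegSplit c ls S) →
  edgesOnLegs sp ≡ coveredOnLegs sp → torsoDegreeOnLegs sp ≡ length ls → legSegmentsᵇ c ls S ≡ true
legSegments-intro [] _ _ = refl
legSegments-intro (_∷_ {s = s} s⊆ sp) edges≡ torso≡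
  with ≤-+-tight (length≤covered s⊆ z<s) (edgesOnLegs≤coveredOnLegs sp) edges≡
     | ≤-+-tight (degree-start≤1 s⊆ z<s) (torsoDegreeOnLegs≤legs sp) torso≡
... | len≡cov , edges≡′ | deg≡1 , torso≡′
  rewrite legSegmentsᵇ-∷ s⊆ sp | sym len≡cov | deg≡1 | ≡ᵇ-refl (length s) = legSegments-intro sp edges≡′ torso≡′

legSegments⇒edges≡covered : ∀ {c ls S} (sp : LegSplit c ls S) → legSegmentsᵇ c ls S ≡ true →
  edgesOnLegs sp ≡ coveredOnLegs sp
legSegments⇒edges≡covered []          _    = refl
legSegments⇒edges≡covered (s⊆ ∷ sp) segs with legSegmentsᵇ-∷-true s⊆ sp segs
... | cov≡ , _ , segs′ = cong₂ _+_ (sym cov≡) (legSegments⇒edges≡covered sp segs′)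

legSegments⇒torsoDegree≡legs : ∀ {c ls S} (sp : LegSplit c ls S) → legSegmentsᵇ c ls S ≡ true →
  torsoDegreeOnLegs sp ≡ length ls
legSegments⇒torsoDegree≡legs []          _    = refl
legSegments⇒torsoDegree≡legs (s⊆ ∷ sp) segs with legSegmentsᵇ-∷-true s⊆ sp segs
... | _ , deg≡ , segs′ = cong₂ _+_ deg≡ (legSegments⇒torsoDegree≡legs sp segs′)

legSegments⇒leafEdges≡legs : ∀ {c ls S} (sp : LegSplit c ls S) → legSegmentsᵇ c ls S ≡ true →
  ∀ D → (D ≡ᵇ 1) ≡ false → leafEdgesOnLegs D sp ≡ length ls
legSegments⇒leafEdges≡legs []          _    _ _    = refl
legSegments⇒leafEdges≡legs (s⊆ ∷ sp) segs D D≢1 with legSegmentsᵇ-∷-true s⊆ sp segs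
... | cov≡ , deg≡ , segs′ =
  cong₂ _+_ (leafEdgesWith-initialSegment {D = D} s⊆ z<s cov≡ deg≡ D≢1) (legSegments⇒leafEdges≡legs sp segs′ D D≢1)

-- Vertex count and connectivity

addVertex : ℕ → List ℕ → List ℕ
addVertex v vs = if memᵇ v vs then vs else v ∷ vs

memᵇ-addVertex : ∀ v x vs → memᵇ v (addVertex x vs) ≡ (v ≡ᵇ x) ∨ memᵇ v vs
memᵇ-addVertex v x vs with memᵇ x vs in x∈vs
... | false = refl
... | true with v ≡ᵇ x in v≡x
...   | false = refl
...   | true  = subst (λ y → memᵇ y vs ≡ true) (sym (≡ᵇ-true⇒≡ {v} {x} v≡x)) x∈vs

length-addVertex : ∀ x vs → length (addVertex x vs) ≡ when (not (memᵇ x vs)) 1 + length vs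
length-addVertex x vs with memᵇ x vs
... | true  = refl
... | false = refl

memᵇ-vertices : ∀ v S → memᵇ v (vertices S) ≡ touches S v
memᵇ-vertices v []             = refl
memᵇ-vertices v ((a , b) ∷ S)
  rewrite memᵇ-addVertex v a (addVertex b (vertices S)) | memᵇ-addVertex v b (vertices S) | memᵇ-vertices v S
  with v ≡ᵇ a | v ≡ᵇ b
... | true  | _     = refl
... | false | true  = refl
... | false | false = refl

countᵇ-range-∨-below : ∀ a m x (q : ℕ → Bool) → x < a →
  countᵇ (λ v → (v ≡ᵇ x) ∨ q v) (range a m) ≡ countᵇ q (range a m)
countᵇ-range-∨-below a m x q x<a =
  countᵇ-cong (All.map (λ {v} (a≤v , _) → cong (_∨ q v) (≢⇒≡ᵇ-false (>⇒≢ (<-≤-trans x<a a≤v)))) (range-bounds a m))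

countᵇ-range-∨ : ∀ a m x (q : ℕ → Bool) → a ≤ x → x < a + m →
  countᵇ (λ v → (v ≡ᵇ x) ∨ q v) (range a m) ≡ when (not (q x)) 1 + countᵇ q (range a m)
countᵇ-range-∨ a zero    x q a≤x x< = contradiction (≤-trans x< (≤-reflexive (+-identityʳ a))) (≤⇒≯ a≤x)
countᵇ-range-∨ a (suc m) x q a≤x x< with a ≟ x
... | yes refl rewrite ≡ᵇ-refl a | countᵇ-range-∨-below (suc a) m a q (n<1+n a) with q a
...   | true  = refl
...   | false = refl
countᵇ-range-∨ a (suc m) x q a≤x x< | no a≢x
  rewrite ≢⇒≡ᵇ-false a≢x | countᵇ-range-∨ (suc a) m x q (≤∧≢⇒< a≤x a≢x) (<-≤-trans x< (≤-reflexive (+-suc a m)))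
  with q a
... | true  = sym (+-suc _ _)
... | false = refl

length-vertices : ∀ n S → All (λ (a , b) → a < n × b < n) S → length (vertices S) ≡ countᵇ (touches S) (range 0 n)
length-vertices n S bounded = trans (go S bounded) (countᵇ-cong (All.tabulate {xs = range 0 n} (λ {v} _ → memᵇ-vertices v S)))
  where
  insert : ∀ x vs → x < n → length vs ≡ countᵇ (λ v → memᵇ v vs) (range 0 n) →
    length (addVertex x vs) ≡ countᵇ (λ v → memᵇ v (addVertex x vs)) (range 0 n)
  insert x vs x<n ih = begin
    length (addVertex x vs)                                 ≡⟨ length-addVertex x vs ⟩
    when (not (memᵇ x vs)) 1 + length vs                    ≡⟨ cong (_+_ (when (not (memᵇ x vs)) 1)) ih ⟩
    when (not (memᵇ x vs)) 1 + countᵇ (λ v → memᵇ v vs) (range 0 n)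
      ≡⟨ countᵇ-range-∨ 0 n x (λ v → memᵇ v vs) z≤n x<n ⟨
    countᵇ (λ v → (v ≡ᵇ x) ∨ memᵇ v vs) (range 0 n)
      ≡⟨ countᵇ-cong (All.tabulate {xs = range 0 n} (λ {v} _ → sym (memᵇ-addVertex v x vs))) ⟩
    countᵇ (λ v → memᵇ v (addVertex x vs)) (range 0 n)     ∎
    where open ≡-Reasoning
  go : ∀ S → All (λ (a , b) → a < n × b < n) S → length (vertices S) ≡ countᵇ (λ v → memᵇ v (vertices S)) (range 0 n)
  go []            []                 = sym (countᵇ-none (All.tabulate {xs = range 0 n} (λ _ → refl)))
  go ((a , b) ∷ S) ((a<n , b<n) ∷ bs) = insert a (addVertex b (vertices S)) a<n (insert b (vertices S) b<n (go S bs))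

touches-++ : ∀ v s t → touches (s ++ t) v ≡ touches s v ∨ touches t v
touches-++ v s t rewrite countᵇ-++ (incident v) s t with degree s v
... | zero  = refl
... | suc _ = refl

any-++ : ∀ {A : Set} (p : A → Bool) xs ys → any p (xs ++ ys) ≡ any p xs ∨ any p ys
any-++ p []       ys = refl
any-++ p (x ∷ xs) ys rewrite any-++ p xs ys = sym (∨-assoc (p x) (any p xs) (any p ys))

memᵇ-++ : ∀ v xs ys → memᵇ v (xs ++ ys) ≡ memᵇ v xs ∨ memᵇ v ys
memᵇ-++ v = any-++ (v ≡ᵇ_)

memᵇ-concatMap : ∀ (f : Edge → List ℕ) {e W} v → e ∈ W → memᵇ v (f e) ≡ true → memᵇ v (concatMap f W) ≡ true
memᵇ-concatMap f {W = x ∷ W} v (here refl) v∈fe rewrite memᵇ-++ v (f x) (concatMap f W) | v∈fe = refl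
memᵇ-concatMap f {W = x ∷ W} v (there e∈W) v∈ rewrite memᵇ-++ v (f x) (concatMap f W) | memᵇ-concatMap f v e∈W v∈ =
  ∨-zeroʳ (memᵇ v (f x))

stepAlong : List ℕ → Edge → List ℕ
stepAlong R e = if memᵇ (proj₁ e) R ∨ memᵇ (proj₂ e) R then proj₁ e ∷ proj₂ e ∷ [] else []

step-mono : ∀ W R v → memᵇ v R ≡ true → memᵇ v (step W R) ≡ true
step-mono W R v v∈R = trans (memᵇ-++ v R (concatMap (stepAlong R) W)) (cong (_∨ memᵇ v (concatMap (stepAlong R) W)) v∈R)

step-edge : ∀ W R {a b} → (a , b) ∈ W → memᵇ a R ≡ true → memᵇ b (step W R) ≡ true
step-edge W R {a} {b} ab∈W a∈R = begin
  memᵇ b (R ++ concatMap (stepAlong R) W)            ≡⟨ memᵇ-++ b R (concatMap (stepAlong R) W) ⟩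
  memᵇ b R ∨ memᵇ b (concatMap (stepAlong R) W)     ≡⟨ cong (memᵇ b R ∨_) (memᵇ-concatMap (stepAlong R) b ab∈W b∈) ⟩
  memᵇ b R ∨ true                                   ≡⟨ ∨-zeroʳ (memᵇ b R) ⟩
  true                                              ∎
  where
  open ≡-Reasoning
  b∈ : memᵇ b (stepAlong R (a , b)) ≡ true
  b∈ rewrite a∈R | ≡ᵇ-refl b = ∨-zeroʳ (b ≡ᵇ a)

module _ {W : List Edge} {R : List ℕ} where

  reached : ℕ → ℕ → Set
  reached k v = memᵇ v (iter k (step W) R) ≡ true

  reached-mono : ∀ {k k′} v → k ≤ k′ → reached k v → reached k′ v
  reached-mono {k} {k′} v k≤k′ v-reached = subst (λ n → reached n v) (m∸n+n≡m k≤k′) (later (k′ ∸ k))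
    where
    later : ∀ m → reached (m + k) v
    later zero    = v-reached
    later (suc m) = step-mono W (iter (m + k) (step W) R) v (later m)

  reached-edge : ∀ {k a b} → (a , b) ∈ W → reached k a → reached (suc k) b
  reached-edge {k} ab∈W = step-edge W (iter k (step W) R) ab∈W

  reach-initialSegment : ∀ {p c l s} k → s ⊆ legEdges p c l → p < c → covered c l s ≡ length s → All (_∈ W) s →
    reached k p → ∀ v → touches s v ≡ true → reached (k + length s) v
  reach-initialSegment {p} {c} {suc l} {_ ∷ s} k (refl ∷ s⊆) p<c cov≡ (pc∈W ∷ s∈W) p-reached v v∈
    with v ≡ᵇ p in v≡p | v ≡ᵇ c in v≡c
  ... | true  | _    rewrite ≡ᵇ-true⇒≡ {v} {p} v≡p = reached-mono p (m≤m+n k (suc (length s))) p-reached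
  ... | false | true rewrite ≡ᵇ-true⇒≡ {v} {c} v≡c =
    reached-mono c (≤-trans (s≤s (m≤m+n k (length s))) (≤-reflexive (sym (+-suc k (length s)))))
                   (reached-edge {k} pc∈W p-reached)
  ... | false | false = subst (λ n → reached n v) (sym (+-suc k (length s)))
    (reach-initialSegment (suc k) s⊆ (n<1+n c) (suc-injective (trans (sym (covered-∷ l s p<c)) cov≡)) s∈W
                          (reached-edge {k} pc∈W p-reached) v v∈)
  reach-initialSegment {p} {c} {suc l} k (_ ∷ʳ s⊆) p<c cov≡ _ _ v v∈
    with covered≡length⇒[] (_ ∷ʳ s⊆) p<c cov≡ (degree-legStart s⊆ p<c)
  ... | refl with v∈
  ...   | ()

  reach-legSegments : ∀ {c ls S} (sp : LegSplit c ls S) → legSegmentsᵇ c ls S ≡ true → All (_∈ W) S →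
    reached 0 0 → ∀ v → touches S v ≡ true → reached (length S) v
  reach-legSegments []                        _    _   _             _ ()
  reach-legSegments (_∷_ {s = s} {t} s⊆ sp) segs S∈W torso-reached v v∈
    with legSegmentsᵇ-∷-true s⊆ sp segs | touches s v in v∈s
  ... | cov≡ , _ , _ | true =
    reached-mono v (≤-trans (m≤m+n (length s) (length t)) (≤-reflexive (sym (length-++ s))))
      (reach-initialSegment 0 s⊆ z<s cov≡ (All.++⁻ˡ s S∈W) torso-reached v v∈s)
  ... | _ , _ , segs′ | false =
    reached-mono v (≤-trans (m≤n+m (length t) (length s)) (≤-reflexive (sym (length-++ s))))
      (reach-legSegments sp segs′ (All.++⁻ʳ s S∈W) torso-reached v v∈t)
    where
    v∈t : touches t v ≡ true
    v∈t = trans (sym (cong (_∨ touches t v) v∈s)) (trans (sym (touches-++ v s t)) v∈)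

-- Subtrees with a leaf edge on every leg

legStart≡1⇒∷ : ∀ {c l s} → s ⊆ legEdges 0 c l → 0 < c → degree s 0 ≡ 1 → ∃ λ s′ → s ≡ (0 , c) ∷ s′
legStart≡1⇒∷ {l = suc l} (refl ∷ s⊆) _ _ = _ , refl
legStart≡1⇒∷ {l = suc l} (_ ∷ʳ s⊆) 0<c deg≡1 rewrite degree-legStart s⊆ 0<c with deg≡1
... | ()

legSegments-firstEdge : ∀ {c ls S} → LegSplit c ls S → legSegmentsᵇ c ls S ≡ true →
  ∀ {a b S′} → S ≡ (a , b) ∷ S′ → a ≡ 0
legSegments-firstEdge (s⊆ ∷ sp) segs S≡ with legSegmentsᵇ-∷-true s⊆ sp segs
... | _ , deg≡1 , _ with legStart≡1⇒∷ s⊆ z<s deg≡1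
...   | _ , refl = sym (cong proj₁ (∷-injectiveˡ S≡))

all-intro : ∀ (p : ℕ → Bool) vs → (∀ v → memᵇ v vs ≡ true → p v ≡ true) → all p vs ≡ true
all-intro p []       _  = refl
all-intro p (x ∷ vs) all-p rewrite all-p x (cong (_∨ memᵇ x vs) (≡ᵇ-refl x)) =
  all-intro p vs (λ v v∈vs → all-p v (trans (cong ((v ≡ᵇ x) ∨_) v∈vs) (∨-zeroʳ (v ≡ᵇ x))))

-- The first edge of S starts at the torso, from which every vertex of S is reached.
legSegments⇒connected : ∀ {ls} S → LegSplit 0 ls S → legSegmentsᵇ 0 ls S ≡ true → connectedᵇ S ≡ true
legSegments⇒connected []            _  _    = refl
legSegments⇒connected ((a , b) ∷ S) sp segs with legSegments-firstEdge sp segs refl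
... | refl = all-intro _ (vertices ((0 , b) ∷ S)) (λ v v∈ →
  reach-legSegments sp segs (All.tabulate (λ e∈ → e∈)) refl v (trans (sym (memᵇ-vertices v ((0 , b) ∷ S))) v∈))

vertices-onLegs : ∀ {ls S} (sp : LegSplit 0 ls S) →
  length (vertices S) ≡ when (not (torsoDegreeOnLegs sp ≡ᵇ 0)) 1 + coveredOnLegs sp
vertices-onLegs {ls} {S} sp = begin
  length (vertices S)
    ≡⟨ length-vertices (suc (sum ls)) S (All.map bounded (legSplit-shape sp)) ⟩
  countᵇ (touches S) (range 0 (suc (sum ls)))
    ≡⟨ covered-suc 0 (sum ls) S ⟩
  when (touches S 0) 1 + countᵇ (touches S) (range 1 (sum ls))
    ≡⟨ cong₂ (λ d n → when (not (d ≡ᵇ 0)) 1 + n) (sym (torsoDegreeOnLegs≡degree sp)) (covered-onLegs {W = S} sp (λ _ → refl)) ⟩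
  when (not (torsoDegreeOnLegs sp ≡ᵇ 0)) 1 + coveredOnLegs sp ∎
  where
  open ≡-Reasoning
  bounded : ∀ {e} → LegEdge 0 1 (sum ls) e → proj₁ e < suc (sum ls) × proj₂ e < suc (sum ls)
  bounded (inj₁ refl , _ , b<)    = z<s , b<
  bounded (inj₂ (_ , a<) , _ , b<) = a< , b<

numLeafEdges-onLegs : ∀ {ls S} (sp : LegSplit 0 ls S) → numLeafEdges S ≡ leafEdgesOnLegs (torsoDegreeOnLegs sp) sp
numLeafEdges-onLegs {S = S} sp =
  trans (leafEdges-onLegs {W = S} sp (λ _ → refl)) (cong (λ d → leafEdgesOnLegs d sp) (sym (torsoDegreeOnLegs≡degree sp)))

cancelEdges : ∀ ℓ E k → ℓ + (E + E) ≤ (E + E) + k → ℓ ≤ k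
cancelEdges ℓ E k bound = +-cancelʳ-≤ (E + E) ℓ k (≤-trans bound (≤-reflexive (+-comm (E + E) k)))

-- E edges, N covered leg vertices and torso degree F: a tree has 1 + E vertices, and the
-- leaf-edge bound then leaves no room unless F is the number ℓ of legs and N = E.
fullTorso : ∀ ℓ E N F → 3 ≤ ℓ → F ≤ ℓ → when (not (F ≡ᵇ 0)) 1 + N ≡ suc E →
  ℓ + (E + E) ≤ (N + N) + F + when (F ≡ᵇ 1) F → E ≡ N × F ≡ ℓ
fullTorso ℓ E N zero 3≤ℓ _ refl bound = contradiction (cancelEdges ℓ E 2 (≤-trans bound (≤-reflexive (solve 1 (λ E →
  ((con 1 :+ E) :+ (con 1 :+ E)) :+ con 0 :+ con 0 := (E :+ E) :+ con 2) refl E)))) (<⇒≱ 3≤ℓ)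
  where open ℕ-Solver.+-*-Solver
fullTorso ℓ E N (suc zero) 3≤ℓ _ N≡ bound rewrite suc-injective N≡ =
  contradiction (cancelEdges ℓ E 2 (≤-trans bound (≤-reflexive (+-assoc (E + E) 1 1)))) (<⇒≱ 3≤ℓ)
fullTorso ℓ E N (suc (suc F)) 3≤ℓ F≤ℓ N≡ bound rewrite suc-injective N≡ =
  refl , ≤-antisym F≤ℓ (cancelEdges ℓ E (suc (suc F)) (≤-trans bound (≤-reflexive (+-identityʳ _))))

isSubtree⇒vertices : ∀ S → isSubtreeᵇ S ≡ true → length (vertices S) ≡ suc (length S)
isSubtree⇒vertices []      ()
isSubtree⇒vertices (e ∷ S) tree = ≡ᵇ-true⇒≡ (proj₂ (∧-true {connectedᵇ (e ∷ S)} tree))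

isSubtree-intro : ∀ S → S ≢ [] → connectedᵇ S ≡ true → length (vertices S) ≡ suc (length S) → isSubtreeᵇ S ≡ true
isSubtree-intro []      S≢[] _         _          = contradiction refl S≢[]
isSubtree-intro (e ∷ S) _    connected vertices≡ rewrite connected | vertices≡ = ≡ᵇ-refl (length S)

subtree⇒legSegments : ∀ {ls S} → 3 ≤ length ls → (sp : LegSplit 0 ls S) →
  isSubtreeᵇ S ≡ true → numLeafEdges S ≡ length ls → legSegmentsᵇ 0 ls S ≡ true
subtree⇒legSegments {ls} {S} 3≤ℓ sp tree leaves
  with fullTorso (length ls) (edgesOnLegs sp) (coveredOnLegs sp) (torsoDegreeOnLegs sp) 3≤ℓ (torsoDegreeOnLegs≤legs sp)
                 vertexCount leafBound
  where
  vertexCount : when (not (torsoDegreeOnLegs sp ≡ᵇ 0)) 1 + coveredOnLegs sp ≡ suc (edgesOnLegs sp)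
  vertexCount = trans (sym (vertices-onLegs sp)) (trans (isSubtree⇒vertices S tree) (cong suc (sym (edgesOnLegs≡length sp))))
  leafBound : length ls + (edgesOnLegs sp + edgesOnLegs sp)
    ≤ (coveredOnLegs sp + coveredOnLegs sp) + torsoDegreeOnLegs sp + when (torsoDegreeOnLegs sp ≡ᵇ 1) (torsoDegreeOnLegs sp)
  leafBound = ≤-trans (≤-reflexive (cong (_+ (edgesOnLegs sp + edgesOnLegs sp)) (trans (sym leaves) (numLeafEdges-onLegs sp))))
                      (leafEdgesOnLegs-bound sp (torsoDegreeOnLegs sp))
... | E≡N , F≡ℓ = legSegments-intro sp E≡N F≡ℓ

legSegments⇒subtree : ∀ {ls} S → 3 ≤ length ls → (sp : LegSplit 0 ls S) → legSegmentsᵇ 0 ls S ≡ true →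
  isSubtreeᵇ S ≡ true × numLeafEdges S ≡ length ls
legSegments⇒subtree {ls} S 3≤ℓ sp segs = isSubtree-intro S nonempty (legSegments⇒connected S sp segs) vertexCount , leafCount
  where
  F≡ℓ : torsoDegreeOnLegs sp ≡ length ls
  F≡ℓ = legSegments⇒torsoDegree≡legs sp segs
  ℓ≢0 : (length ls ≡ᵇ 0) ≡ false
  ℓ≢0 = ≢⇒≡ᵇ-false (>⇒≢ (<-trans z<s (<-trans (s≤s z<s) 3≤ℓ)))
  ℓ≢1 : (length ls ≡ᵇ 1) ≡ false
  ℓ≢1 = ≢⇒≡ᵇ-false (>⇒≢ (<-trans (s≤s z<s) 3≤ℓ))
  nonempty : S ≢ []
  nonempty refl = contradiction (trans (sym F≡ℓ) (torsoDegreeOnLegs≡degree sp)) (>⇒≢ (<-trans (s≤s z≤n) 3≤ℓ))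
  vertexCount : length (vertices S) ≡ suc (length S)
  vertexCount = begin
    length (vertices S)                                        ≡⟨ vertices-onLegs sp ⟩
    when (not (torsoDegreeOnLegs sp ≡ᵇ 0)) 1 + coveredOnLegs sp ≡⟨ cong (λ d → when (not (d ≡ᵇ 0)) 1 + coveredOnLegs sp) F≡ℓ ⟩
    when (not (length ls ≡ᵇ 0)) 1 + coveredOnLegs sp            ≡⟨ cong (λ b → when (not b) 1 + coveredOnLegs sp) ℓ≢0 ⟩
    suc (coveredOnLegs sp)                                     ≡⟨ cong suc (legSegments⇒edges≡covered sp segs) ⟨
    suc (edgesOnLegs sp)                                       ≡⟨ cong suc (edgesOnLegs≡length sp) ⟩
    suc (length S)                                             ∎
    where open ≡-Reasoning
  leafCount : numLeafEdges S ≡ length ls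
  leafCount rewrite numLeafEdges-onLegs sp | F≡ℓ = legSegments⇒leafEdges≡legs sp segs (length ls) ℓ≢1

subtreeWithAllLegs≡legSegments : ∀ {ls S} → 3 ≤ length ls → S ⊆ spiderEdges ls →
  isSubtreeᵇ S ∧ (numLeafEdges S ≡ᵇ length ls) ≡ legSegmentsᵇ 0 ls S
subtreeWithAllLegs≡legSegments {ls} {S} 3≤ℓ S⊆ = ⇔→≡ {z = true} (mk⇔ to from)
  where
  sp : LegSplit 0 ls S
  sp = legSplit 0 ls S⊆
  to : isSubtreeᵇ S ∧ (numLeafEdges S ≡ᵇ length ls) ≡ true → legSegmentsᵇ 0 ls S ≡ true
  to h = subtree⇒legSegments 3≤ℓ sp (proj₁ (∧-true h)) (≡ᵇ-true⇒≡ (proj₂ (∧-true {isSubtreeᵇ S} h)))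
  from : legSegmentsᵇ 0 ls S ≡ true → isSubtreeᵇ S ∧ (numLeafEdges S ≡ᵇ length ls) ≡ true
  from segs with legSegments⇒subtree S 3≤ℓ sp segs
  ... | tree , leaves rewrite tree | leaves = ≡ᵇ-refl (length ls)

-- Coefficients of the subtree polynomial

countᵇ-∧ : ∀ {A : Set} b (q : A → Bool) xs → countᵇ (λ x → b ∧ q x) xs ≡ when b (countᵇ q xs)
countᵇ-∧ true  q xs = refl
countᵇ-∧ false q xs = countᵇ-none (All.tabulate {xs = xs} (λ _ → refl))

legSegments-count : ∀ c ls k i →
  countᵇ (λ S → legSegmentsᵇ c ls S ∧ (k + length S ≡ᵇ i)) (sublists (spiderEdges′ (suc c) ls)) ≡ boundedCompositions ls k i
legSegments-count c [] k i rewrite +-identityʳ k with k ≡ᵇ i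
... | true  = refl
... | false = refl
legSegments-count c (l ∷ ls) k i = begin
  countᵇ P (sublists (leg ++ rest))
    ≡⟨ countᵇ-sublists-++ P leg rest ⟩
  sum (map (λ s → countᵇ (P ∘ (s ++_)) (sublists rest)) (sublists leg))
    ≡⟨ sum-map-cong (All.map onLeg (sublists-⊆ leg)) ⟩
  sum (map (λ s → when (legSegmentᵇ (suc c) l s) (boundedCompositions ls (k + length s) i)) (sublists leg))
    ≡⟨ ∑-nonemptyInitialSegments l (λ a → boundedCompositions ls (k + a) i) z<s ⟩
  boundedCompositions (l ∷ ls) k i ∎
  where
  open ≡-Reasoning
  leg rest : List Edge
  leg  = legEdges 0 (suc c) l
  rest = spiderEdges′ (suc (c + l)) ls
  P : List Edge → Bool
  P S = legSegmentsᵇ c (l ∷ ls) S ∧ (k + length S ≡ᵇ i)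
  onLeg : ∀ {s} → s ⊆ leg →
    countᵇ (P ∘ (s ++_)) (sublists rest) ≡ when (legSegmentᵇ (suc c) l s) (boundedCompositions ls (k + length s) i)
  onLeg {s} s⊆ = begin
    countᵇ (P ∘ (s ++_)) (sublists rest)
      ≡⟨ countᵇ-cong (All.map split (sublists-⊆ rest)) ⟩
    countᵇ (λ t → legSegmentᵇ (suc c) l s ∧ (legSegmentsᵇ (c + l) ls t ∧ ((k + length s) + length t ≡ᵇ i))) (sublists rest)
      ≡⟨ countᵇ-∧ (legSegmentᵇ (suc c) l s) _ (sublists rest) ⟩
    when (legSegmentᵇ (suc c) l s) (countᵇ (λ t → legSegmentsᵇ (c + l) ls t ∧ ((k + length s) + length t ≡ᵇ i)) (sublists rest))
      ≡⟨ cong (when (legSegmentᵇ (suc c) l s)) (legSegments-count (c + l) ls (k + length s) i) ⟩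
    when (legSegmentᵇ (suc c) l s) (boundedCompositions ls (k + length s) i) ∎
    where
    split : ∀ {t} → t ⊆ rest →
      P (s ++ t) ≡ legSegmentᵇ (suc c) l s ∧ (legSegmentsᵇ (c + l) ls t ∧ ((k + length s) + length t ≡ᵇ i))
    split {t} t⊆ rewrite legSegmentsᵇ-∷ s⊆ (legSplit (c + l) ls t⊆) | length-++ s {t} | +-assoc k (length s) (length t) =
      ∧-assoc (legSegmentᵇ (suc c) l s) (legSegmentsᵇ (c + l) ls t) _

subtreeCoeff-allLegs : ∀ ls → 3 ≤ length ls → ∀ i → subtreeCoeff (spiderEdges ls) i (length ls) ≡ boundedCompositions ls 0 i
subtreeCoeff-allLegs ls 3≤ℓ i = trans (countᵇ-cong (All.map regroup (sublists-⊆ (spiderEdges ls)))) (legSegments-count 0 ls 0 i)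
  where
  regroup : ∀ {S} → S ⊆ spiderEdges ls →
    isSubtreeᵇ S ∧ (length S ≡ᵇ i) ∧ (numLeafEdges S ≡ᵇ length ls) ≡ legSegmentsᵇ 0 ls S ∧ (length S ≡ᵇ i)
  regroup {S} S⊆ = begin
    isSubtreeᵇ S ∧ (length S ≡ᵇ i) ∧ (numLeafEdges S ≡ᵇ length ls)   ≡⟨ cong (isSubtreeᵇ S ∧_) (∧-comm (length S ≡ᵇ i) _) ⟩
    isSubtreeᵇ S ∧ (numLeafEdges S ≡ᵇ length ls) ∧ (length S ≡ᵇ i)   ≡⟨ ∧-assoc (isSubtreeᵇ S) _ _ ⟨
    (isSubtreeᵇ S ∧ (numLeafEdges S ≡ᵇ length ls)) ∧ (length S ≡ᵇ i)
      ≡⟨ cong (_∧ (length S ≡ᵇ i)) (subtreeWithAllLegs≡legSegments {ls} 3≤ℓ S⊆) ⟩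
    legSegmentsᵇ 0 ls S ∧ (length S ≡ᵇ i)                            ∎
    where open ≡-Reasoning

countᵇ-sublists-full : ∀ {A : Set} (a b : List A → Bool) xs →
  countᵇ (λ S → a S ∧ (length S ≡ᵇ length xs) ∧ b S) (sublists xs) ≡ when (a xs ∧ b xs) 1
countᵇ-sublists-full a b [] with a [] | b []
... | true  | true  = refl
... | true  | false = refl
... | false | _     = refl
countᵇ-sublists-full {A} a b (x ∷ xs) = begin
  countᵇ P (map (x ∷_) (sublists xs) ++ sublists xs)
    ≡⟨ countᵇ-++ P (map (x ∷_) (sublists xs)) (sublists xs) ⟩
  countᵇ P (map (x ∷_) (sublists xs)) + countᵇ P (sublists xs)
    ≡⟨ cong₂ _+_ (trans (countᵇ-map P (x ∷_) (sublists xs)) (countᵇ-sublists-full (a ∘ (x ∷_)) (b ∘ (x ∷_)) xs))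
                 (countᵇ-none (All.map short (sublists-⊆ xs))) ⟩
  when (a (x ∷ xs) ∧ b (x ∷ xs)) 1 + 0
    ≡⟨ +-identityʳ _ ⟩
  when (a (x ∷ xs) ∧ b (x ∷ xs)) 1 ∎
  where
  open ≡-Reasoning
  P : List A → Bool
  P S = a S ∧ (length S ≡ᵇ suc (length xs)) ∧ b S
  short : ∀ {S} → S ⊆ xs → P S ≡ false
  short {S} S⊆ rewrite ≢⇒≡ᵇ-false (<⇒≢ (s≤s (length-mono-≤ S⊆))) = ∧-zeroʳ (a S)

subtreeCoeff-beyond : ∀ E {i} j → length E < i → subtreeCoeff E i j ≡ 0
subtreeCoeff-beyond E {i} j E<i = countᵇ-none (All.map short (sublists-⊆ E))
  where
  short : ∀ {S} → S ⊆ E → isSubtreeᵇ S ∧ (length S ≡ᵇ i) ∧ (numLeafEdges S ≡ᵇ j) ≡ false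
  short {S} S⊆ rewrite ≢⇒≡ᵇ-false (<⇒≢ (≤-<-trans (length-mono-≤ S⊆) E<i)) = ∧-zeroʳ (isSubtreeᵇ S)

length-legEdges : ∀ p c l → length (legEdges p c l) ≡ l
length-legEdges p c zero    = refl
length-legEdges p c (suc l) = cong suc (length-legEdges c (suc c) l)

covered-legEdges : ∀ {p c} l → p < c → covered c l (legEdges p c l) ≡ length (legEdges p c l)
covered-legEdges {p} {c} l p<c = ≤-antisym
  (≤-trans (countᵇ≤length _ (range c l)) (≤-reflexive (trans (length-range c l) (sym (length-legEdges p c l)))))
  (length≤covered {l = l} ⊆-refl p<c)

legSegment-full : ∀ c l → 1 ≤ l → legSegmentᵇ (suc c) l (legEdges 0 (suc c) l) ≡ true
legSegment-full c (suc l) _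
  rewrite covered-legEdges {0} {suc c} (suc l) z<s
        | degree-∷-start {0} {suc c} (legEdges (suc c) (suc (suc c)) l)
        | degree-legStart (⊆-refl {x = legEdges (suc c) (suc (suc c)) l}) z<s
        | ≡ᵇ-refl (length (legEdges (suc c) (suc (suc c)) l)) = refl

legSegments-full : ∀ c ls → All (1 ≤_) ls → legSegmentsᵇ c ls (spiderEdges′ (suc c) ls) ≡ true
legSegments-full c []       []             = refl
legSegments-full c (l ∷ ls) (1≤l ∷ 1≤ls)
  rewrite legSegmentsᵇ-∷ (⊆-refl {x = legEdges 0 (suc c) l}) (legSplit (c + l) ls ⊆-refl)
        | legSegment-full c l 1≤l = legSegments-full (c + l) ls 1≤ls

subtreeCoeff-full : ∀ ls → IsSpiderPartition ls → ∀ j →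
  subtreeCoeff (spiderEdges ls) (length (spiderEdges ls)) j ≡ when (length ls ≡ᵇ j) 1
subtreeCoeff-full ls (1≤ls , _ , 3≤ℓ) j
  with legSegments⇒subtree (spiderEdges ls) 3≤ℓ (legSplit 0 ls ⊆-refl) (legSegments-full 0 ls 1≤ls)
... | tree , leaves = trans (countᵇ-sublists-full isSubtreeᵇ (λ S → numLeafEdges S ≡ᵇ j) (spiderEdges ls))
                            (cong (λ b → when b 1) (cong₂ (λ t n → t ∧ (n ≡ᵇ j)) tree leaves))

Isomorphic-refl : ∀ n E → Isomorphic n E n E
Isomorphic-refl n E = ↔-id (Fin n) , λ _ _ → record { to = id ; from = id }

-- Only the whole spider has as many edges as the spider, and it has one leaf edge per leg.
sameSubtreePoly⇒edges≤ : ∀ {lam mu} → IsSpiderPartition lam →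
  SameSubtreePoly (spiderEdges lam) (spiderEdges mu) → length (spiderEdges lam) ≤ length (spiderEdges mu)
sameSubtreePoly⇒edges≤ {lam} {mu} spλ same = ≮⇒≥ λ μ<λ → 1≢0 (begin
  1                                                                          ≡⟨ cong (λ b → when b 1) (≡ᵇ-refl (length lam)) ⟨
  when (length lam ≡ᵇ length lam) 1                                          ≡⟨ subtreeCoeff-full lam spλ (length lam) ⟨
  subtreeCoeff (spiderEdges lam) (length (spiderEdges lam)) (length lam)   ≡⟨ same _ _ ⟩
  subtreeCoeff (spiderEdges mu) (length (spiderEdges lam)) (length lam)    ≡⟨ subtreeCoeff-beyond (spiderEdges mu) (length lam) μ<λ ⟩
  0                                                                          ∎)
  where
  open ≡-Reasoning
  1≢0 : 1 ≢ 0
  1≢0 ()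

sameSubtreePoly⇒legs≡ : ∀ {lam mu} → IsSpiderPartition lam → IsSpiderPartition mu →
  SameSubtreePoly (spiderEdges lam) (spiderEdges mu) → length lam ≡ length mu
sameSubtreePoly⇒legs≡ {lam} {mu} spλ spμ same = sym (≡ᵇ-true⇒≡ (when-1 (begin
  when (length mu ≡ᵇ length lam) 1                                          ≡⟨ subtreeCoeff-full mu spμ (length lam) ⟨
  subtreeCoeff (spiderEdges mu) (length (spiderEdges mu)) (length lam)
    ≡⟨ cong (λ n → subtreeCoeff (spiderEdges mu) n (length lam)) edges≡ ⟨
  subtreeCoeff (spiderEdges mu) (length (spiderEdges lam)) (length lam)   ≡⟨ same _ _ ⟨
  subtreeCoeff (spiderEdges lam) (length (spiderEdges lam)) (length lam)  ≡⟨ subtreeCoeff-full lam spλ (length lam) ⟩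
  when (length lam ≡ᵇ length lam) 1                                         ≡⟨ cong (λ b → when b 1) (≡ᵇ-refl (length lam)) ⟩
  1                                                                         ∎)))
  where
  open ≡-Reasoning
  edges≡ : length (spiderEdges lam) ≡ length (spiderEdges mu)
  edges≡ = ≤-antisym (sameSubtreePoly⇒edges≤ {lam} {mu} spλ same)
                     (sameSubtreePoly⇒edges≤ {mu} {lam} spμ (λ i j → sym (same i j)))

theorem3p1 : (lam mu : List ℕ) → IsSpiderPartition lam → IsSpiderPartition mu →
    SameSubtreePoly (spiderEdges lam) (spiderEdges mu) →
    Isomorphic (spiderSize lam) (spiderEdges lam) (spiderSize mu) (spiderEdges mu)
theorem3p1 lam mu spλ@(1≤λ , ↘λ , 3≤ℓλ) spμ@(1≤μ , ↘μ , 3≤ℓμ) same =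
  subst (λ ν → Isomorphic (spiderSize lam) (spiderEdges lam) (spiderSize ν) (spiderEdges ν)) lam≡mu
        (Isomorphic-refl (spiderSize lam) (spiderEdges lam))
  where
  legs≡ : length lam ≡ length mu
  legs≡ = sameSubtreePoly⇒legs≡ spλ spμ same
  lam≡mu : lam ≡ mu
  lam≡mu = boundedCompositions-injective ↘λ ↘μ 1≤λ 1≤μ legs≡ (λ i → begin
    boundedCompositions lam 0 i                   ≡⟨ subtreeCoeff-allLegs lam 3≤ℓλ i ⟨
    subtreeCoeff (spiderEdges lam) i (length lam) ≡⟨ same i (length lam) ⟩
    subtreeCoeff (spiderEdges mu) i (length lam)  ≡⟨ cong (subtreeCoeff (spiderEdges mu) i) legs≡ ⟩
    subtreeCoeff (spiderEdges mu) i (length mu)   ≡⟨ subtreeCoeff-allLegs mu 3≤ℓμ i ⟩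
    boundedCompositions mu 0 i                    ∎)
    where open ≡-Reasoning
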